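{- Let $k\ge 3$ and $n$ be positive integers, let $h$ be an integer with $k\le h\le 2n$, and let $H$ be a blue cycle of length $n+h$. Let $r=0$ if $h$ is even and $r=1$ if $h$ is odd. Then $\tilde{r}_H(C_k,\{C_{n+r},C_{n+r+1},C_{n+r+2}\})\le k+1$.
   Context: Online Ramsey game: Builder and Painter play on the infinite complete graph $K_{\mathbb N}$. For a colored graph $H$ (each edge red or blue) and nonempty families $\mathcal G_1,\mathcal G_2$ of finite graphs, the game $\tilde R_H(\mathcal G_1,\mathcal G_2)$ starts with a copy of $H$ already drawn and colored on the board. In each round Builder selects a previously unselected edge and Painter colors it red or blue. The game ends as soon as the graph of all colored edges contains a red copy of a graph in $\mathcal G_1$ or a blue copy of a graph in $\mathcal G_2$. $\tilde{r}_H(\mathcal G_1,\mathcal G_2)$ is the minimum number of rounds within which Builder can guarantee the end, both playing optimally; a single graph stands for the one-element family. $C_k$ is the cycle on $k$ vertices. -}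

module Defs where

open import Data.Nat using (ℕ; zero; suc; _+_; _*_; _∸_; _≤_; _<_)
open import Data.Nat.DivMod using (_%_)
open import Data.Product using (Σ; _×_; _,_)
open import Data.Sum using (_⊎_)
open import Data.List using (List; []; _∷_; _++_; map; upTo)
open import Data.List.Relation.Unary.Any using (Any)
open import Relation.Binary.PropositionalEquality using (_≡_; _≢_)
open import Relation.Nullary using (¬_)

data Colour : Set where
  red blue : Colour

-- A board: the finite list of coloured edges drawn so far on K_ℕ
-- (vertices are natural numbers; an edge {u,v} is stored as (u , v , c)).
Board : Set
Board = List (ℕ × ℕ × Colour)

Selected : Board → ℕ → ℕ → Set
Selected B u v = Any (λ { (a , b , _) → (a ≡ u × b ≡ v) ⊎ (a ≡ v × b ≡ u) }) B

HasEdge : Board → Colour → ℕ → ℕ → Set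
HasEdge B c u v =
  Any (λ { (a , b , c') → c' ≡ c × ((a ≡ u × b ≡ v) ⊎ (a ≡ v × b ≡ u)) }) B

ContainsCycle : Board → Colour → ℕ → Set
ContainsCycle B c m =
  3 ≤ m ×
  Σ (ℕ → ℕ) λ f →
    (∀ i j → i < m → j < m → f i ≡ f j → i ≡ j) ×
    (∀ i → suc i < m → HasEdge B c (f i) (f (suc i))) ×
    HasEdge B c (f (m ∸ 1)) (f 0)

-- Builder can force the game (with end condition `End`) to end within t
-- further rounds from board B, whatever Painter does.
BuilderWinsWithin : (Board → Set) → ℕ → Board → Set
BuilderWinsWithin End zero B = End B
BuilderWinsWithin End (suc t) B =
  End B ⊎
  Σ ℕ λ u → Σ ℕ λ v →
    u ≢ v × ¬ Selected B u v ×
    (∀ (c : Colour) → BuilderWinsWithin End t ((u , v , c) ∷ B))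

blueCycle : ℕ → Board
blueCycle N =
  map (λ i → (i , suc i , blue)) (upTo (N ∸ 1)) ++ ((N ∸ 1 , 0 , blue) ∷ [])

EndCk-Cm3 : ℕ → ℕ → Board → Set
EndCk-Cm3 k m B =
  ContainsCycle B red k ⊎
  ContainsCycle B blue m ⊎
  ContainsCycle B blue (m + 1) ⊎
  ContainsCycle B blue (m + 2)

parity : ℕ → ℕ
parity h = h % 2

-- Write h = 2q + r and m = n + r, so that H has N = m + 2q vertices 0, …, N-1. A blue chord
-- {a, a+d} closes a blue cycle of length d + 1 with the inner arc of H and one of length
-- N + 1 - d with the outer arc, so the game ends as soon as Painter colours blue a chord of
-- span m - 1, m or m + 1, or of span 2q - 1, 2q or 2q + 1. Builder fixes a k-cycle made of
-- such chords and draws its edges one by one; each must be red, and then a red C_k appears.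
-- For even k the cycle zigzags between [0, j) and [m, m + j); for odd k it is closed through
-- the extra vertex m + q when m ≤ q + 1. Otherwise Builder first draws {m, m+q}. If it is
-- blue, the zigzag between [q, q + j) and [q + m, q + m + j) closed through 0 has two edges
-- each of which completes a blue C_{m+2} with {m, m+q}. If it is red, Builder draws {m+q, 0}:
-- if that is blue he uses a zigzag of span 2q closed through m, otherwise the two red chords
-- close the zigzag of the even case through m + q. For q = 1, H itself is a C_{m+2}, and the
-- hexagon m = 2 is settled by two explicit cycles.

module Submission where

open import Defs
open import Data.Bool using (Bool; true; false; if_then_else_; not; T)
open import Data.Bool.Properties using (not-involutive)
open import Data.Empty using (⊥-elim)
open import Function using (_∘_)
open import Data.List using (_∷_; map; upTo)
open import Data.List.Relation.Unary.Any using (here; there)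
import Data.List.Relation.Unary.Any.Properties as Any
open import Data.List.Membership.Propositional using (find; lose)
open import Data.List.Membership.Propositional.Properties using (∈-upTo⁺)
open import Data.Nat hiding (parity)
open import Data.Nat.DivMod using (_/_; m≡m%n+[m/n]*n; m%n<n)
open import Data.Nat.Properties
open import Data.Nat.Tactic.RingSolver using (solve-∀)
open import Data.Product using (Σ; _×_; _,_; proj₁; proj₂)
open import Data.Sum using (_⊎_; inj₁; inj₂)
open import Data.Unit using (tt)
open import Relation.Binary using (tri<; tri≈; tri>)
open import Relation.Binary.PropositionalEquality
open import Relation.Nullary using (¬_; yes; no)
open import Relation.Nullary.Decidable using (True; toWitness)

SameEdge : ℕ → ℕ → ℕ → ℕ → Set
SameEdge a b u v = (a ≡ u × b ≡ v) ⊎ (a ≡ v × b ≡ u)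

HasEdge-sym : ∀ {B c u v} → HasEdge B c u v → HasEdge B c v u
HasEdge-sym (here (p , inj₁ (a , b))) = here (p , inj₂ (a , b))
HasEdge-sym (here (p , inj₂ (a , b))) = here (p , inj₁ (a , b))
HasEdge-sym (there e) = there (HasEdge-sym e)

Selected-sym : ∀ {B u v} → Selected B u v → Selected B v u
Selected-sym (here (inj₁ (a , b))) = here (inj₂ (a , b))
Selected-sym (here (inj₂ (a , b))) = here (inj₁ (a , b))
Selected-sym (there s) = there (Selected-sym s)

HasEdge-here : ∀ {B c u v} → HasEdge ((u , v , c) ∷ B) c u v
HasEdge-here = here (refl , inj₁ (refl , refl))

Selected-∷⁻ : ∀ {a b c B u v} → Selected ((a , b , c) ∷ B) u v → SameEdge a b u v ⊎ Selected B u v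
Selected-∷⁻ (here p) = inj₁ p
Selected-∷⁻ (there p) = inj₂ p

winsWithin-end : ∀ {End : Board → Set} t {B} → End B → BuilderWinsWithin End t B
winsWithin-end zero e = e
winsWithin-end (suc t) e = inj₁ e

winsWithin-suc : ∀ {End : Board → Set} t {B} → BuilderWinsWithin End t B → BuilderWinsWithin End (suc t) B
winsWithin-suc zero e = inj₁ e
winsWithin-suc (suc t) (inj₁ e) = inj₁ e
winsWithin-suc (suc t) (inj₂ (u , v , u≢v , fresh , next)) =
  inj₂ (u , v , u≢v , fresh , λ c → winsWithin-suc t (next c))

winsWithin-mono : ∀ {End : Board → Set} {t t' B} → t ≤ t' → BuilderWinsWithin End t B → BuilderWinsWithin End t' B
winsWithin-mono {t = t} {B = B} t≤t' w with m≤n⇒∃[o]m+o≡n t≤t'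
... | d , refl = pad d
  where
  pad : ∀ d → BuilderWinsWithin _ (t + d) B
  pad zero rewrite +-identityʳ t = w
  pad (suc d) rewrite +-suc t d = winsWithin-suc (t + d) (pad d)

HamiltonCycleIn : ℕ → Board → Set
HamiltonCycleIn N B = (∀ i → suc i < N → HasEdge B blue i (suc i)) × HasEdge B blue (N ∸ 1) 0

HamiltonCycleIn-∷ : ∀ {N B} e → HamiltonCycleIn N B → HamiltonCycleIn N (e ∷ B)
HamiltonCycleIn-∷ e (path , closing) = (λ i p → there (path i p)) , there closing

blueCycle-hamiltonian : ∀ N → HamiltonCycleIn N (blueCycle N)
blueCycle-hamiltonian N =
  (λ i p → Any.++⁺ˡ (Any.map⁺ (lose (∈-upTo⁺ (∸-monoˡ-≤ 1 p)) (refl , inj₁ (refl , refl))))) ,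
  Any.++⁺ʳ (map (λ i → (i , suc i , blue)) (upTo (N ∸ 1))) HasEdge-here

Selected-blueCycle⁻ : ∀ N {u v} → Selected (blueCycle N) u v →
  suc u ≡ v ⊎ suc v ≡ u ⊎ (u ≡ N ∸ 1 × v ≡ 0) ⊎ (v ≡ N ∸ 1 × u ≡ 0)
Selected-blueCycle⁻ N s with Any.++⁻ (map (λ i → (i , suc i , blue)) (upTo (N ∸ 1))) s
... | inj₁ t with find (Any.map⁻ t)
...   | _ , _ , inj₁ (refl , refl) = inj₁ refl
...   | _ , _ , inj₂ (refl , refl) = inj₂ (inj₁ refl)
Selected-blueCycle⁻ N s | inj₂ (here (inj₁ (refl , refl))) = inj₂ (inj₂ (inj₁ (refl , refl)))
Selected-blueCycle⁻ N s | inj₂ (here (inj₂ (refl , refl))) = inj₂ (inj₂ (inj₂ (refl , refl)))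

2≤⇒≢0 : ∀ {x} → 2 ≤ x → x ≢ 0
2≤⇒≢0 (s≤s _) ()

-- The hypothesis for a = 0 rules out the closing edge {N-1, 0}.
¬Selected-blueCycle-chord : ∀ N a d → 2 ≤ d → (a ≡ 0 → suc (a + d) < N) → ¬ Selected (blueCycle N) a (a + d)
¬Selected-blueCycle-chord N a d 2≤d notClosing s with Selected-blueCycle⁻ N s
... | inj₁ e = <-irrefl (+-cancelˡ-≡ a 1 d (trans (+-comm a 1) e)) 2≤d
... | inj₂ (inj₁ e) = <-irrefl refl (≤-trans (s≤s (m≤m+n a d)) (≤-reflexive e))
... | inj₂ (inj₂ (inj₁ (_ , a+d≡0))) = 2≤⇒≢0 (≤-trans 2≤d (m≤n+m d a)) a+d≡0
... | inj₂ (inj₂ (inj₂ (a+d≡N-1 , a≡0))) = <-irrefl a+d≡N-1 (∸-monoˡ-≤ 1 (notClosing a≡0))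

-- Blue cycles made of arcs of the Hamiltonian cycle

∸1<self : ∀ {n} → 1 ≤ n → n ∸ 1 < n
∸1<self {suc n} _ = n<1+n n

suc-∸1 : ∀ {n} → 1 ≤ n → suc (n ∸ 1) ≡ n
suc-∸1 {suc n} _ = refl

Chain : (ℕ → ℕ → Set) → ℕ → (ℕ → ℕ) → Set
Chain R L f = ∀ i → suc i < L → R (f i) (f (suc i))

module _ {L : ℕ} {f : ℕ → ℕ} (step : Chain _<_ L f) where
  increasing : ∀ {i j} → i < j → j < L → f i < f j
  increasing {i} {suc j} i<1+j 1+j<L with m≤n⇒m<n∨m≡n (≤-pred i<1+j)
  ... | inj₁ i<j = <-trans (increasing i<j (<-trans (n<1+n j) 1+j<L)) (step j 1+j<L)
  ... | inj₂ refl = step i 1+j<L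

  increasing-injective : ∀ i j → i < L → j < L → f i ≡ f j → i ≡ j
  increasing-injective i j i<L j<L e with <-cmp i j
  ... | tri< i<j _ _ = ⊥-elim (<-irrefl e (increasing i<j j<L))
  ... | tri≈ _ i≡j _ = i≡j
  ... | tri> _ _ j<i = ⊥-elim (<-irrefl (sym e) (increasing j<i i<L))

-- y ≡ suc x stands for an edge of the Hamiltonian cycle.
BlueAdvance : Board → ℕ → ℕ → Set
BlueAdvance B x y = x < y × (y ≡ suc x ⊎ HasEdge B blue x y)

increasingBlueCycle : ∀ {B N L f} → HamiltonCycleIn N B → 3 ≤ L → Chain (BlueAdvance B) L f →
  f (L ∸ 1) < N → HasEdge B blue (f (L ∸ 1)) (f 0) → ContainsCycle B blue L
increasingBlueCycle {B} {N} {L} {f} (path , _) 3≤L chain last<N closing =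
  3≤L , f , increasing-injective ascending , edge , closing
  where
  ascending : Chain _<_ L f
  ascending i p = proj₁ (chain i p)
  atMostLast : ∀ i → i < L → f i ≤ f (L ∸ 1)
  atMostLast i i<L with m≤n⇒m<n∨m≡n (∸-monoˡ-≤ 1 i<L)
  ... | inj₁ i<last = <⇒≤ (increasing ascending i<last (∸1<self (≤-trans (s≤s z≤n) 3≤L)))
  ... | inj₂ refl = ≤-refl
  edge : ∀ i → suc i < L → HasEdge B blue (f i) (f (suc i))
  edge i p with proj₂ (chain i p)
  ... | inj₂ chord = chord
  ... | inj₁ e = subst (HasEdge B blue (f i)) (sym e)
                   (path (f i) (subst (_< N) e (≤-<-trans (atMostLast (suc i) p) last<N)))

<ᵇ-true : ∀ {i j} → i < j → (i <ᵇ j) ≡ true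
<ᵇ-true {i} {j} i<j with i <ᵇ j | <⇒<ᵇ i<j
... | true | _ = refl

<ᵇ-false : ∀ {i j} → j ≤ i → (i <ᵇ j) ≡ false
<ᵇ-false {i} {j} j≤i with i <ᵇ j in eq
... | false = refl
... | true = ⊥-elim (<-irrefl refl (≤-<-trans j≤i (<ᵇ⇒< i j (subst T (sym eq) tt))))

_⟨_⟩_ : (ℕ → ℕ) → ℕ → (ℕ → ℕ) → ℕ → ℕ
(f ⟨ n ⟩ g) i = if i <ᵇ n then f i else g (i ∸ n)

⟨⟩-left : ∀ f n g {i} → i < n → (f ⟨ n ⟩ g) i ≡ f i
⟨⟩-left f n g i<n rewrite <ᵇ-true i<n = refl

⟨⟩-right : ∀ f n g x → (f ⟨ n ⟩ g) (n + x) ≡ g x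
⟨⟩-right f n g x rewrite <ᵇ-false (m≤m+n n x) = cong g (m+n∸m≡n n x)

⟨⟩-at : ∀ f n g → (f ⟨ n ⟩ g) n ≡ g 0
⟨⟩-at f n g = trans (cong (f ⟨ n ⟩ g) (sym (+-identityʳ n))) (⟨⟩-right f n g 0)

⟨⟩-last : ∀ f n g l → (f ⟨ suc n ⟩ g) (n + suc l) ≡ g l
⟨⟩-last f n g l = trans (cong (f ⟨ suc n ⟩ g) (+-suc n l)) (⟨⟩-right f (suc n) g l)

⟨⟩-chain : ∀ {R : ℕ → ℕ → Set} {f g n l} → Chain R (suc n) f → R (f n) (g 0) → Chain R l g →
  Chain R (suc n + l) (f ⟨ suc n ⟩ g)
⟨⟩-chain {R} {f} {g} {n} {l} chainF bridge chainG i 1+i<L with <-cmp i n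
... | tri< i<n _ _ =
  subst₂ R (sym (⟨⟩-left f (suc n) g (<-trans i<n (n<1+n n)))) (sym (⟨⟩-left f (suc n) g (s≤s i<n)))
    (chainF i (s≤s i<n))
... | tri≈ _ refl _ =
  subst₂ R (sym (⟨⟩-left f (suc n) g (n<1+n n))) (sym (⟨⟩-at f (suc n) g)) bridge
... | tri> _ _ n<i with m≤n⇒∃[o]m+o≡n n<i
...   | x , refl =
  subst₂ R (sym (⟨⟩-right f (suc n) g x))
    (sym (trans (cong (f ⟨ suc n ⟩ g) (sym (+-suc (suc n) x))) (⟨⟩-right f (suc n) g (suc x))))
    (chainG x (+-cancelˡ-< (suc n) (suc x) l (subst (_< suc n + l) (sym (+-suc (suc n) x)) 1+i<L)))

arc-chain : ∀ {B} a l → Chain (BlueAdvance B) l (a +_)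
arc-chain a l i _ = +-monoʳ-< a (n<1+n i) , inj₁ (+-suc a i)

3≤twoArcs : ∀ p₀ p₁ → 1 ≤ p₀ + p₁ → 3 ≤ suc p₀ + suc p₁
3≤twoArcs p₀ p₁ 1≤p = s≤s (subst (2 ≤_) (sym (+-suc p₀ p₁)) (s≤s 1≤p))

oneArcCycle : ∀ {B N} a p → HamiltonCycleIn N B → 2 ≤ p → a + p < N → HasEdge B blue (a + p) a →
  ContainsCycle B blue (suc p)
oneArcCycle {B} a p ham 2≤p a+p<N closing =
  increasingBlueCycle ham (s≤s 2≤p) (arc-chain a (suc p)) a+p<N
    (subst (HasEdge B blue (a + p)) (sym (+-identityʳ a)) closing)

twoArcCycle : ∀ {B N} p₀ p₁ a₀ a₁ → HamiltonCycleIn N B → 1 ≤ p₀ + p₁ →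
  BlueAdvance B (a₀ + p₀) a₁ → a₁ + p₁ < N → HasEdge B blue (a₁ + p₁) a₀ →
  ContainsCycle B blue (suc p₀ + suc p₁)
twoArcCycle {B} p₀ p₁ a₀ a₁ ham 1≤p jump last<N closing =
  increasingBlueCycle {f = (a₀ +_) ⟨ suc p₀ ⟩ (a₁ +_)} ham (3≤twoArcs p₀ p₁ 1≤p)
    (⟨⟩-chain {R = BlueAdvance B} (arc-chain a₀ (suc p₀))
      (subst (BlueAdvance B (a₀ + p₀)) (sym (+-identityʳ a₁)) jump) (arc-chain a₁ (suc p₁)))
    (subst (_< _) (sym last) last<N)
    (subst₂ (HasEdge B blue) (sym last) (sym (trans (⟨⟩-left (a₀ +_) (suc p₀) (a₁ +_) (s≤s z≤n)) (+-identityʳ a₀))) closing)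
  where
  last : ((a₀ +_) ⟨ suc p₀ ⟩ (a₁ +_)) (p₀ + suc p₁) ≡ a₁ + p₁
  last = ⟨⟩-last (a₀ +_) p₀ (a₁ +_) p₁

threeArcCycle : ∀ {B N} p₀ p₁ p₂ a₀ a₁ a₂ → HamiltonCycleIn N B →
  BlueAdvance B (a₀ + p₀) a₁ → BlueAdvance B (a₁ + p₁) a₂ → a₂ + p₂ < N → HasEdge B blue (a₂ + p₂) a₀ →
  ContainsCycle B blue (suc p₀ + (suc p₁ + suc p₂))
threeArcCycle {B} p₀ p₁ p₂ a₀ a₁ a₂ ham jump₀₁ jump₁₂ last<N closing =
  increasingBlueCycle {f = (a₀ +_) ⟨ suc p₀ ⟩ g} ham (s≤s (≤-trans (s≤s (≤-trans (s≤s z≤n) (m≤n+m (suc p₂) p₁))) (m≤n+m _ p₀)))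
    (⟨⟩-chain {R = BlueAdvance B} (arc-chain a₀ (suc p₀)) (subst (BlueAdvance B (a₀ + p₀)) (sym first₁₂) jump₀₁)
      (⟨⟩-chain {R = BlueAdvance B} (arc-chain a₁ (suc p₁))
        (subst (BlueAdvance B (a₁ + p₁)) (sym (+-identityʳ a₂)) jump₁₂) (arc-chain a₂ (suc p₂))))
    (subst (_< _) (sym last) last<N)
    (subst₂ (HasEdge B blue) (sym last) (sym (trans (⟨⟩-left (a₀ +_) (suc p₀) g (s≤s z≤n)) (+-identityʳ a₀))) closing)
  where
  g : ℕ → ℕ
  g = (a₁ +_) ⟨ suc p₁ ⟩ (a₂ +_)
  first₁₂ : g 0 ≡ a₁
  first₁₂ = trans (⟨⟩-left (a₁ +_) (suc p₁) (a₂ +_) (s≤s z≤n)) (+-identityʳ a₁)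
  last : ((a₀ +_) ⟨ suc p₀ ⟩ g) (p₀ + suc (p₁ + suc p₂)) ≡ a₂ + p₂
  last = trans (⟨⟩-last (a₀ +_) p₀ g (p₁ + suc p₂)) (⟨⟩-last (a₁ +_) p₁ (a₂ +_) p₂)

blueCycleEnds : ∀ {k m B L} → m ≤ L → L ≤ m + 2 → ContainsCycle B blue L → EndCk-Cm3 k m B
blueCycleEnds {m = m} {B} m≤L L≤m+2 cycle with m≤n⇒∃[o]m+o≡n m≤L
... | 0 , refl = inj₂ (inj₁ (subst (ContainsCycle B blue) (+-identityʳ m) cycle))
... | 1 , refl = inj₂ (inj₂ (inj₁ cycle))
... | 2 , refl = inj₂ (inj₂ (inj₂ cycle))
... | suc (suc (suc t)) , refl with +-cancelˡ-≤ m _ _ L≤m+2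
...   | s≤s (s≤s ())

innerChordEnds : ∀ {k m N B} a d → HamiltonCycleIn N B → 2 ≤ d → m ≤ suc d → suc d ≤ m + 2 →
  a + d < N → HasEdge B blue a (a + d) → EndCk-Cm3 k m B
innerChordEnds a d ham 2≤d m≤L L≤m+2 a+d<N chord =
  blueCycleEnds m≤L L≤m+2 (oneArcCycle a d ham 2≤d a+d<N (HasEdge-sym chord))

-- The outer arc of the chord {a, a+d} together with the chord is a cycle of length N + 1 - d.
outerChordEnds : ∀ {k m N B} a d → HamiltonCycleIn N B → suc d < N → 1 ≤ d → a + d < N →
  m + d ≤ suc N → suc N ≤ m + 2 + d → HasEdge B blue a (a + d) → EndCk-Cm3 k m B
outerChordEnds {m = m} {N} {B} a d ham d+1<N 1≤d a+d<N lower upper chord with m≤n⇒∃[o]m+o≡n a+d<N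
... | e , refl =
  blueCycleEnds m≤L L≤m+2
    (twoArcCycle a e 0 (a + d) ham 1≤a+e (m<m+n a 1≤d , inj₂ chord) ≤-refl (proj₂ ham))
  where
  outerArcLength : ∀ a d e → suc a + suc e + d ≡ suc (suc (a + d + e))
  outerArcLength = solve-∀
  outerArcInterior : ∀ a d e → a + d + e ≡ a + e + d
  outerArcInterior = solve-∀
  L : ℕ
  L = suc a + suc e
  L+d : suc N ≡ L + d
  L+d = sym (outerArcLength a d e)
  m≤L : m ≤ L
  m≤L = +-cancelʳ-≤ d m L (subst (m + d ≤_) L+d lower)
  L≤m+2 : L ≤ m + 2
  L≤m+2 = +-cancelʳ-≤ d L (m + 2) (subst (_≤ m + 2 + d) L+d upper)
  1≤a+e : 1 ≤ a + e
  1≤a+e = +-cancelʳ-≤ d 1 (a + e) (subst (suc d ≤_) (outerArcInterior a d e) (≤-pred d+1<N))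

hamiltonCycle-end : ∀ {k m B} → 1 ≤ m → HamiltonCycleIn (m + 2) B → EndCk-Cm3 k m B
hamiltonCycle-end {m = m} {B} 1≤m ham =
  blueCycleEnds (≤-trans (n≤1+n m) (n≤1+n (suc m))) (≤-reflexive (+-comm 2 m))
    (oneArcCycle 0 (suc m) ham (s≤s 1≤m) (≤-reflexive (+-comm 2 m))
      (subst (λ x → HasEdge B blue x 0) last (proj₂ ham)))
  where
  last : m + 2 ∸ 1 ≡ suc m
  last = cong (_∸ 1) (+-comm m 2)

module _ {k m q : ℕ} {B : Board} (ham : HamiltonCycleIn (m + (q + q)) B) (1≤q : 1 ≤ q) where

  private
    m+q<N : m + q < m + (q + q)
    m+q<N = +-monoʳ-< m (m<m+n q 1≤q)

    m+2 : ∀ {x} → x + q ≡ m → suc (suc (x + q)) ≡ m + 2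
    m+2 refl = +-comm 2 _

  chords[m,m+q][m+q,0]-end : 1 ≤ m → HasEdge B blue m (m + q) → HasEdge B blue (m + q) 0 → EndCk-Cm3 k m B
  chords[m,m+q][m+q,0]-end 1≤m upper back =
    blueCycleEnds (≤-trans (m≤m+n m 1) (n≤1+n _)) (≤-reflexive (sym (+-suc m 1)))
      (twoArcCycle m 0 0 (m + q) ham (≤-trans 1≤m (m≤m+n m 0)) (m<m+n m 1≤q , inj₂ upper)
        (subst (_< m + (q + q)) (sym (+-identityʳ (m + q))) m+q<N)
        (subst (λ x → HasEdge B blue x 0) (sym (+-identityʳ (m + q))) back))

  chords[m,m+q][0,q]-end : q ≤ m → HasEdge B blue m (m + q) → HasEdge B blue 0 q → EndCk-Cm3 k m B
  chords[m,m+q][0,q]-end q≤m upper lower =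
    blueCycleEnds (≤-trans (m≤m+n m 2) (≤-reflexive (sym length))) (≤-reflexive length)
      (threeArcCycle 0 (m ∸ q) (q ∸ 1) 0 q (m + q) ham (1≤q , inj₂ lower)
        (subst (λ x → BlueAdvance B x (m + q)) (sym (m+[n∸m]≡n q≤m)) (m<m+n m 1≤q , inj₂ upper))
        (subst (_< m + (q + q)) last (∸1<self (≤-trans 1≤q (≤-trans (m≤n+m q q) (m≤n+m (q + q) m)))))
        (subst (λ x → HasEdge B blue x 0) last (proj₂ ham)))
    where
    last : m + (q + q) ∸ 1 ≡ m + q + (q ∸ 1)
    last = trans (cong (_∸ 1) (sym (+-assoc m q q))) (+-∸-assoc (m + q) 1≤q)
    length : suc 0 + (suc (m ∸ q) + suc (q ∸ 1)) ≡ m + 2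
    length = trans (cong (λ x → suc (suc (m ∸ q) + x)) (suc-∸1 1≤q)) (m+2 (m∸n+n≡m q≤m))

  chords[m∸q,m][m+q,0]-end : q < m → HasEdge B blue (m ∸ q) m → HasEdge B blue (m + q) 0 → EndCk-Cm3 k m B
  chords[m∸q,m][m+q,0]-end q<m lower back =
    blueCycleEnds (≤-trans (m≤m+n m 2) (≤-reflexive (sym length))) (≤-reflexive length)
      (twoArcCycle (m ∸ q) q 0 m ham (≤-trans 1≤q (m≤n+m q (m ∸ q)))
        (∸-monoʳ-< {m} {q} {0} 1≤q (<⇒≤ q<m) , inj₂ lower) m+q<N back)
    where
    length : suc (m ∸ q) + suc q ≡ m + 2
    length = trans (cong suc (+-suc (m ∸ q) q)) (m+2 (m∸n+n≡m (<⇒≤ q<m)))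

-- Drawing a red cycle

-- Builder draws the edges {f i, f (i+1)}, i < s, of the cycle f 0, …, f (L-1) in turn, the
-- remaining ones being red already; Painter must colour each of them red, as a blue one ends
-- the game.
module RedCycleStrategy
  (End Good : Board → Set)
  (Good-red : ∀ {B} u v → Good B → Good ((u , v , red) ∷ B))
  (L s : ℕ) (f : ℕ → ℕ) (s≤L : s ≤ L) (3≤L : 3 ≤ L)
  (f-injective : ∀ i j → i < L → j < L → f i ≡ f j → i ≡ j)
  (f-closed : f L ≡ f 0)
  (B₀ : Board)
  (fresh : ∀ i → i < s → ¬ Selected B₀ (f i) (f (suc i)))
  (blue-ends : ∀ i → i < s → ∀ B → Good B → End ((f i , f (suc i) , blue) ∷ B))
  (red-already : ∀ i → s ≤ i → i < L → HasEdge B₀ red (f i) (f (suc i)))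
  (Good₀ : Good B₀)
  (redCycle-ends : ∀ B → ContainsCycle B red L → End B) where

  private
    0<L : 0 < L
    0<L = ≤-trans (s≤s z≤n) 3≤L

    CycleEdge : ℕ → ℕ → ℕ → Set
    CycleEdge i u v = SameEdge (f i) (f (suc i)) u v

    Progress : ℕ → Board → Set
    Progress p B = Good B × (∀ i → i < p → HasEdge B red (f i) (f (suc i))) ×
                   (∀ i → s ≤ i → i < L → HasEdge B red (f i) (f (suc i))) ×
                   (∀ u v → Selected B u v → Selected B₀ u v ⊎ Σ ℕ (λ i → i < p × CycleEdge i u v))

    edge-proper : ∀ p → p < L → f p ≢ f (suc p)
    edge-proper p p<L e with m≤n⇒m<n∨m≡n p<L
    ... | inj₁ 1+p<L = 1+n≢n (sym (f-injective p (suc p) p<L 1+p<L e))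
    ... | inj₂ 1+p≡L with f-injective p 0 p<L 0<L (trans e (trans (cong f 1+p≡L) f-closed))
    ...   | refl = <-irrefl 1+p≡L (≤-trans (s≤s (s≤s z≤n)) 3≤L)

    edges-distinct : ∀ p i → p < L → i < p → ¬ CycleEdge i (f p) (f (suc p))
    edges-distinct p i p<L i<p (inj₁ (e , _)) = <-irrefl (f-injective i p (<-trans i<p p<L) p<L e) i<p
    edges-distinct p i p<L i<p (inj₂ (e , e')) with f-injective (suc i) p (≤-<-trans i<p p<L) p<L e'
    ... | refl with m≤n⇒m<n∨m≡n p<L
    ...   | inj₁ 2+i<L = <-irrefl (f-injective i (suc (suc i)) (<-trans i<p p<L) 2+i<L e) (<-trans (n<1+n i) (n<1+n (suc i)))
    ...   | inj₂ 2+i≡L with f-injective i 0 (<-trans i<p p<L) 0<L (trans e (trans (cong f 2+i≡L) f-closed))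
    ...     | refl = <-irrefl 2+i≡L 3≤L

    completed : ∀ B → Progress s B → End B
    completed B (_ , drawn , old , _) = redCycle-ends B (3≤L , f , f-injective , (λ i p → edge i (<-trans (n<1+n i) p)) , closing)
      where
      edge : ∀ i → i < L → HasEdge B red (f i) (f (suc i))
      edge i i<L with i <? s
      ... | yes i<s = drawn i i<s
      ... | no i≮s = old i (≮⇒≥ i≮s) i<L
      closing : HasEdge B red (f (L ∸ 1)) (f 0)
      closing = subst (HasEdge B red (f (L ∸ 1))) (trans (cong f (suc-∸1 0<L)) f-closed) (edge (L ∸ 1) (∸1<self 0<L))

    draw : ∀ p B → p < s → Progress p B → Progress (suc p) ((f p , f (suc p) , red) ∷ B)
    draw p B p<s (good , drawn , old , selected) = Good-red _ _ good , drawn′ , (λ i s≤i i<L → there (old i s≤i i<L)) , selected′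
      where
      drawn′ : ∀ i → i < suc p → HasEdge ((f p , f (suc p) , red) ∷ B) red (f i) (f (suc i))
      drawn′ i i<1+p with m≤n⇒m<n∨m≡n (≤-pred i<1+p)
      ... | inj₁ i<p = there (drawn i i<p)
      ... | inj₂ refl = HasEdge-here
      selected′ : ∀ u v → Selected ((f p , f (suc p) , red) ∷ B) u v →
        Selected B₀ u v ⊎ Σ ℕ (λ i → i < suc p × CycleEdge i u v)
      selected′ u v (here e) = inj₂ (p , n<1+n p , e)
      selected′ u v (there sel) with selected u v sel
      ... | inj₁ old-sel = inj₁ old-sel
      ... | inj₂ (i , i<p , e) = inj₂ (i , <-trans i<p (n<1+n p) , e)

    play : ∀ t p B → t + p ≡ s → Progress p B → BuilderWinsWithin End t B
    play zero p B refl progress = completed B progress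
    play (suc t) p B t+p≡s progress@(good , _ , _ , selected) =
      inj₂ (f p , f (suc p) , edge-proper p (≤-trans p<s s≤L) , unselected ,
            λ { red → play t (suc p) _ (trans (+-suc t p) t+p≡s) (draw p B p<s progress)
              ; blue → winsWithin-end t (blue-ends p p<s B good) })
      where
      p<s : p < s
      p<s = subst (p <_) t+p≡s (s≤s (m≤n+m p t))
      unselected : ¬ Selected B (f p) (f (suc p))
      unselected sel with selected _ _ sel
      ... | inj₁ old-sel = fresh p p<s old-sel
      ... | inj₂ (i , i<p , e) = edges-distinct p i (≤-trans p<s s≤L) i<p e

  wins : BuilderWinsWithin End s B₀
  wins = play s 0 B₀ (+-identityʳ s) (Good₀ , (λ _ ()) , red-already , (λ _ _ → inj₁))

drawRedCycle-wins : ∀ {End : Board → Set} N L (f : ℕ → ℕ) → 3 ≤ L →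
  (∀ i j → i < L → j < L → f i ≡ f j → i ≡ j) → f L ≡ f 0 →
  (∀ i → i < L → ¬ Selected (blueCycle N) (f i) (f (suc i))) →
  (∀ i → i < L → ∀ B → HamiltonCycleIn N B → End ((f i , f (suc i) , blue) ∷ B)) →
  (∀ B → ContainsCycle B red L → End B) → BuilderWinsWithin End L (blueCycle N)
drawRedCycle-wins {End} N L f 3≤L f-injective f-closed fresh blue-ends redCycle-ends =
  RedCycleStrategy.wins End (HamiltonCycleIn N) (λ _ _ → HamiltonCycleIn-∷ _) L L f ≤-refl 3≤L f-injective f-closed
    (blueCycle N) fresh blue-ends (λ i L≤i i<L → ⊥-elim (<⇒≱ i<L L≤i)) (blueCycle-hamiltonian N) redCycle-ends

-- Zigzags

isEven : ℕ → Bool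
isEven zero = true
isEven (suc n) = not (isEven n)

-- Vertex i < 2j of the zigzag is b + x on the lower or b + D + x on the upper side: the
-- offset x runs 0, 1, …, j-1, j-1, …, 1, 0 while the side alternates, so the zigzag starts at
-- b, ends at b + D, and each of its edges spans D - 1, D or D + 1.
upper : ℕ → ℕ → Bool
upper j i = if i <ᵇ j then not (isEven i) else isEven (j + j ∸ suc i)

offset : ℕ → ℕ → ℕ
offset j i = if i <ᵇ j then i else j + j ∸ suc i

zigzag : ℕ → ℕ → ℕ → ℕ → ℕ
zigzag b D j i = b + (if upper j i then D else 0) + offset j i

upper-offset-< : ∀ j i → i < j → upper j i ≡ not (isEven i) × offset j i ≡ i
upper-offset-< j i i<j rewrite <ᵇ-true i<j = refl , refl

upper-offset-≥ : ∀ j i → j ≤ i → upper j i ≡ isEven (j + j ∸ suc i) × offset j i ≡ j + j ∸ suc i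
upper-offset-≥ j i j≤i rewrite <ᵇ-false j≤i = refl , refl

mirror<j : ∀ j i → j ≤ i → i < j + j → j + j ∸ suc i < j
mirror<j j i j≤i i<2j =
  +-cancelˡ-< (suc i) _ _ (subst (_< suc i + j) (sym (m+[n∸m]≡n i<2j)) (+-monoˡ-< j (s≤s j≤i)))

offset<j : ∀ j i → i < j + j → offset j i < j
offset<j j i i<2j with i <? j
... | yes i<j rewrite proj₂ (upper-offset-< j i i<j) = i<j
... | no i≮j rewrite proj₂ (upper-offset-≥ j i (≮⇒≥ i≮j)) = mirror<j j i (≮⇒≥ i≮j) i<2j

not-≢ : ∀ b → not b ≢ b
not-≢ true ()
not-≢ false ()

position-injective : ∀ j i i′ → i < j + j → i′ < j + j →
  upper j i ≡ upper j i′ → offset j i ≡ offset j i′ → i ≡ i′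
position-injective j i i′ i<2j i′<2j same-side same-offset with i <? j | i′ <? j
... | yes i<j | yes i′<j =
  trans (sym (proj₂ (upper-offset-< j i i<j))) (trans same-offset (proj₂ (upper-offset-< j i′ i′<j)))
... | no i≮j | no i′≮j =
  suc-injective (+-cancelʳ-≡ _ (suc i) (suc i′)
    (trans (m+[n∸m]≡n i<2j) (trans (sym (m+[n∸m]≡n i′<2j)) (cong (suc i′ +_) (sym mirrored)))))
  where
  mirrored : j + j ∸ suc i ≡ j + j ∸ suc i′
  mirrored = trans (sym (proj₂ (upper-offset-≥ j i (≮⇒≥ i≮j))))
               (trans same-offset (proj₂ (upper-offset-≥ j i′ (≮⇒≥ i′≮j))))
... | yes i<j | no i′≮j =
  ⊥-elim (not-≢ _ (trans (trans (sym (proj₁ (upper-offset-< j i i<j)))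
                                 (trans same-side (proj₁ (upper-offset-≥ j i′ (≮⇒≥ i′≮j)))))
                          (cong isEven (sym x≡x′))))
  where
  x≡x′ : i ≡ j + j ∸ suc i′
  x≡x′ = trans (sym (proj₂ (upper-offset-< j i i<j))) (trans same-offset (proj₂ (upper-offset-≥ j i′ (≮⇒≥ i′≮j))))
... | no i≮j | yes i′<j =
  ⊥-elim (not-≢ _ (trans (trans (sym (proj₁ (upper-offset-< j i′ i′<j)))
                                 (trans (sym same-side) (proj₁ (upper-offset-≥ j i (≮⇒≥ i≮j)))))
                          (cong isEven (sym x′≡x))))
  where
  x′≡x : i′ ≡ j + j ∸ suc i
  x′≡x = trans (sym (proj₂ (upper-offset-< j i′ i′<j))) (trans (sym same-offset) (proj₂ (upper-offset-≥ j i (≮⇒≥ i≮j))))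

level-injective : ∀ b D t t′ x x′ → x < D → x′ < D →
  b + (if t then D else 0) + x ≡ b + (if t′ then D else 0) + x′ → t ≡ t′ × x ≡ x′
level-injective b D true true x x′ _ _ e = refl , +-cancelˡ-≡ (b + D) _ _ e
level-injective b D false false x x′ _ _ e = refl , +-cancelˡ-≡ (b + 0) _ _ e
level-injective b D true false x x′ _ x′<D e =
  ⊥-elim (<-irrefl (sym e′) (<-≤-trans (+-monoʳ-< b x′<D) (+-monoʳ-≤ b (m≤m+n D x))))
  where
  e′ : b + (D + x) ≡ b + x′
  e′ = trans (sym (+-assoc b D x)) (trans e (cong (_+ x′) (+-identityʳ b)))
level-injective b D false true x x′ x<D _ e =
  ⊥-elim (<-irrefl e′ (<-≤-trans (+-monoʳ-< b x<D) (+-monoʳ-≤ b (m≤m+n D x′))))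
  where
  e′ : b + x ≡ b + (D + x′)
  e′ = trans (cong (_+ x) (sym (+-identityʳ b))) (trans e (+-assoc b D x′))

zigzag-injective : ∀ b D j → j ≤ D → ∀ i i′ → i < j + j → i′ < j + j → zigzag b D j i ≡ zigzag b D j i′ → i ≡ i′
zigzag-injective b D j j≤D i i′ i<2j i′<2j e =
  position-injective j i i′ i<2j i′<2j (proj₁ same) (proj₂ same)
  where
  same : upper j i ≡ upper j i′ × offset j i ≡ offset j i′
  same = level-injective b D (upper j i) (upper j i′) (offset j i) (offset j i′)
           (<-≤-trans (offset<j j i i<2j) j≤D) (<-≤-trans (offset<j j i′ i′<2j) j≤D) e

m∸n≡1+[m∸1+n] : ∀ m n → n < m → m ∸ n ≡ suc (m ∸ suc n)
m∸n≡1+[m∸1+n] (suc m) zero _ = refl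
m∸n≡1+[m∸1+n] (suc m) (suc n) (s≤s n<m) = m∸n≡1+[m∸1+n] m n n<m

Adjacent : ℕ → ℕ → Set
Adjacent x x′ = x′ ≡ suc x ⊎ x′ ≡ x ⊎ x ≡ suc x′

zigzag-step : ∀ j i → suc i < j + j → upper j i ≡ not (upper j (suc i)) × Adjacent (offset j i) (offset j (suc i))
zigzag-step j i 1+i<2j with suc i <? j
... | yes 1+i<j rewrite <ᵇ-true (<-trans (n<1+n i) 1+i<j) | <ᵇ-true 1+i<j =
  cong not (sym (not-involutive (isEven i))) , inj₁ refl
... | no 1+i≮j with i <? j
...   | yes i<j with ≤-antisym i<j (≮⇒≥ 1+i≮j)
...     | refl rewrite <ᵇ-true i<j | <ᵇ-false (≤-refl {suc i}) | m+n∸n≡m i (suc i) = refl , inj₂ (inj₁ refl)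
zigzag-step j i 1+i<2j | no 1+i≮j | no i≮j
  rewrite <ᵇ-false (≮⇒≥ i≮j) | <ᵇ-false (≤-trans (≮⇒≥ i≮j) (n≤1+n i)) | m∸n≡1+[m∸1+n] (j + j) (suc i) 1+i<2j =
  refl , inj₂ (inj₂ refl)

NearSpan : ℕ → ℕ → ℕ → Set
NearSpan D a b = Σ ℕ λ d → (b ≡ a + d ⊎ a ≡ b + d) × D ≤ suc d × d ≤ suc D

private
  span-up : ∀ b D y → b + suc D + suc y ≡ b + 0 + y + suc (suc D)
  span-up = solve-∀
  span-level : ∀ b D y → b + suc D + y ≡ b + 0 + y + suc D
  span-level = solve-∀
  span-down : ∀ b D y → b + suc D + y ≡ b + 0 + suc y + D
  span-down = solve-∀

nearSpan-sides : ∀ b D t x x′ → 1 ≤ D → Adjacent x x′ →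
  NearSpan D (b + (if not t then D else 0) + x) (b + (if t then D else 0) + x′)
nearSpan-sides b (suc D) true x _ _ (inj₁ refl) = suc (suc D) , inj₁ (span-up b D x) , ≤-trans (n≤1+n _) (n≤1+n _) , ≤-refl
nearSpan-sides b (suc D) true x _ _ (inj₂ (inj₁ refl)) = suc D , inj₁ (span-level b D x) , n≤1+n _ , n≤1+n _
nearSpan-sides b (suc D) true _ x′ _ (inj₂ (inj₂ refl)) = D , inj₁ (span-down b D x′) , ≤-refl , ≤-trans (n≤1+n D) (n≤1+n _)
nearSpan-sides b (suc D) false x _ _ (inj₁ refl) = D , inj₂ (span-down b D x) , ≤-refl , ≤-trans (n≤1+n D) (n≤1+n _)
nearSpan-sides b (suc D) false x _ _ (inj₂ (inj₁ refl)) = suc D , inj₂ (span-level b D x) , n≤1+n _ , n≤1+n _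
nearSpan-sides b (suc D) false _ x′ _ (inj₂ (inj₂ refl)) = suc (suc D) , inj₂ (span-up b D x′) , ≤-trans (n≤1+n _) (n≤1+n _) , ≤-refl

zigzag-nearSpan : ∀ b D j i → 1 ≤ D → suc i < j + j → NearSpan D (zigzag b D j i) (zigzag b D j (suc i))
zigzag-nearSpan b D j i 1≤D 1+i<2j with zigzag-step j i 1+i<2j
... | sides , adjacent =
  subst (λ t → NearSpan D (b + (if t then D else 0) + offset j i) (zigzag b D j (suc i))) (sym sides)
    (nearSpan-sides b D (upper j (suc i)) (offset j i) (offset j (suc i)) 1≤D adjacent)

zigzag-first : ∀ b D j → 1 ≤ j → zigzag b D j 0 ≡ b
zigzag-first b D j 1≤j rewrite <ᵇ-true 1≤j = trans (+-identityʳ _) (+-identityʳ _)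

zigzag-last : ∀ b D j → 1 ≤ j → zigzag b D j (j + j ∸ 1) ≡ b + D
zigzag-last b D (suc j) _ rewrite <ᵇ-false (m≤n+m (suc j) j) | n∸n≡0 (j + suc j) =
  +-identityʳ _

zigzag-≥ : ∀ b D j i → b ≤ zigzag b D j i
zigzag-≥ b D j i = ≤-trans (m≤m+n b _) (m≤m+n _ _)

zigzag-lower⊎upper : ∀ b D j i → i < j + j →
  zigzag b D j i < b + j ⊎ (b + D ≤ zigzag b D j i × zigzag b D j i < b + D + j)
zigzag-lower⊎upper b D j i i<2j with upper j i | offset<j j i i<2j
... | true | x<j = inj₂ (m≤m+n _ _ , +-monoʳ-< (b + D) x<j)
... | false | x<j = inj₁ (subst (λ z → z + offset j i < b + j) (sym (+-identityʳ b)) (+-monoʳ-< b x<j))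

zigzag-< : ∀ b D j i → i < j + j → zigzag b D j i < b + D + j
zigzag-< b D j i i<2j with zigzag-lower⊎upper b D j i i<2j
... | inj₁ lower = <-≤-trans lower (+-monoˡ-≤ j (m≤m+n b D))
... | inj₂ (_ , upper<) = upper<

_◂_ : ℕ → (ℕ → ℕ) → ℕ → ℕ
(v ◂ g) zero = v
(v ◂ g) (suc i) = g i

closedZigzag : ℕ → ℕ → ℕ → ℕ → ℕ
closedZigzag b D j = zigzag b D j ⟨ j + j ⟩ λ _ → b

zigzagVia : ℕ → ℕ → ℕ → ℕ → ℕ → ℕ
zigzagVia b D j v = zigzag b D j ⟨ j + j ⟩ (v ◂ λ _ → b)

viaZigzag : ℕ → ℕ → ℕ → ℕ → ℕ → ℕ
viaZigzag b D j v = v ◂ (zigzag b D j ⟨ j + j ⟩ λ _ → v)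

module _ (b D j : ℕ) (1≤j : 1 ≤ j) where

  private
    Z : ℕ → ℕ
    Z = zigzag b D j

    toB : ℕ → ℕ
    toB _ = b

    0<2j : 0 < j + j
    0<2j = ≤-trans 1≤j (m≤m+n j j)

  data ClosedZigzagEdge (i : ℕ) : Set where
    along : suc i < j + j → closedZigzag b D j i ≡ Z i → closedZigzag b D j (suc i) ≡ Z (suc i) → ClosedZigzagEdge i
    back : closedZigzag b D j i ≡ b + D → closedZigzag b D j (suc i) ≡ b → ClosedZigzagEdge i

  closedZigzagEdge : ∀ i → i < j + j → ClosedZigzagEdge i
  closedZigzagEdge i i<2j with m≤n⇒m<n∨m≡n i<2j
  ... | inj₁ 1+i<2j = along 1+i<2j (⟨⟩-left Z (j + j) toB i<2j) (⟨⟩-left Z (j + j) toB 1+i<2j)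
  ... | inj₂ 1+i≡2j = back (trans (⟨⟩-left Z (j + j) toB i<2j) (trans (cong Z (cong (_∸ 1) 1+i≡2j)) (zigzag-last b D j 1≤j)))
                           (trans (cong (closedZigzag b D j) 1+i≡2j) (⟨⟩-at Z (j + j) toB))

  closedZigzag-closed : closedZigzag b D j (j + j) ≡ closedZigzag b D j 0
  closedZigzag-closed = trans (⟨⟩-at Z (j + j) toB) (sym (trans (⟨⟩-left Z (j + j) toB 0<2j) (zigzag-first b D j 1≤j)))

  closedZigzag-injective : j ≤ D → ∀ i i′ → i < j + j → i′ < j + j → closedZigzag b D j i ≡ closedZigzag b D j i′ → i ≡ i′
  closedZigzag-injective j≤D i i′ i<2j i′<2j e =
    zigzag-injective b D j j≤D i i′ i<2j i′<2j
      (trans (sym (⟨⟩-left Z (j + j) toB i<2j)) (trans e (⟨⟩-left Z (j + j) toB i′<2j)))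

  module _ (v : ℕ) where

    private
      viaB : ℕ → ℕ
      viaB = v ◂ toB

      toV : ℕ → ℕ
      toV _ = v

      zigzagVia-at : ∀ i → i < j + j → zigzagVia b D j v i ≡ Z i
      zigzagVia-at i i<2j = ⟨⟩-left Z (j + j) viaB i<2j

      zigzagVia-v : zigzagVia b D j v (j + j) ≡ v
      zigzagVia-v = ⟨⟩-at Z (j + j) viaB

      zigzagVia-end : zigzagVia b D j v (suc (j + j)) ≡ b
      zigzagVia-end = trans (cong (zigzagVia b D j v) (+-comm 1 (j + j))) (⟨⟩-right Z (j + j) viaB 1)

      viaZigzag-at : ∀ i → i < j + j → viaZigzag b D j v (suc i) ≡ Z i
      viaZigzag-at i i<2j = ⟨⟩-left Z (j + j) toV i<2j

    data ZigzagViaEdge (i : ℕ) : Set where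
      along : suc i < j + j → zigzagVia b D j v i ≡ Z i → zigzagVia b D j v (suc i) ≡ Z (suc i) → ZigzagViaEdge i
      toVia : suc i ≡ j + j → zigzagVia b D j v i ≡ b + D → zigzagVia b D j v (suc i) ≡ v → ZigzagViaEdge i
      fromVia : i ≡ j + j → zigzagVia b D j v i ≡ v → zigzagVia b D j v (suc i) ≡ b → ZigzagViaEdge i

    zigzagViaEdge : ∀ i → i < suc (j + j) → ZigzagViaEdge i
    zigzagViaEdge i i<L with m≤n⇒m<n∨m≡n (≤-pred i<L)
    ... | inj₂ refl = fromVia refl zigzagVia-v zigzagVia-end
    ... | inj₁ i<2j with m≤n⇒m<n∨m≡n i<2j
    ...   | inj₁ 1+i<2j = along 1+i<2j (zigzagVia-at i i<2j) (zigzagVia-at (suc i) 1+i<2j)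
    ...   | inj₂ 1+i≡2j =
      toVia 1+i≡2j (trans (zigzagVia-at i i<2j) (trans (cong Z (cong (_∸ 1) 1+i≡2j)) (zigzag-last b D j 1≤j)))
        (trans (cong (zigzagVia b D j v) 1+i≡2j) zigzagVia-v)

    zigzagVia-closed : zigzagVia b D j v (suc (j + j)) ≡ zigzagVia b D j v 0
    zigzagVia-closed = trans zigzagVia-end (sym (trans (zigzagVia-at 0 0<2j) (zigzag-first b D j 1≤j)))

    zigzagVia-injective : j ≤ D → (∀ i → i < j + j → Z i ≢ v) →
      ∀ i i′ → i < suc (j + j) → i′ < suc (j + j) → zigzagVia b D j v i ≡ zigzagVia b D j v i′ → i ≡ i′
    zigzagVia-injective j≤D v-new i i′ i<L i′<L e with m≤n⇒m<n∨m≡n (≤-pred i<L) | m≤n⇒m<n∨m≡n (≤-pred i′<L)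
    ... | inj₁ i<2j | inj₁ i′<2j =
      zigzag-injective b D j j≤D i i′ i<2j i′<2j (trans (sym (zigzagVia-at i i<2j)) (trans e (zigzagVia-at i′ i′<2j)))
    ... | inj₂ refl | inj₂ refl = refl
    ... | inj₁ i<2j | inj₂ refl = ⊥-elim (v-new i i<2j (trans (sym (zigzagVia-at i i<2j)) (trans e zigzagVia-v)))
    ... | inj₂ refl | inj₁ i′<2j = ⊥-elim (v-new i′ i′<2j (trans (sym (zigzagVia-at i′ i′<2j)) (trans (sym e) zigzagVia-v)))

    data ViaZigzagEdge (i : ℕ) : Set where
      fromVia : i ≡ 0 → viaZigzag b D j v i ≡ v → viaZigzag b D j v (suc i) ≡ b → ViaZigzagEdge i
      along : ∀ i′ → i ≡ suc i′ → suc i′ < j + j →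
        viaZigzag b D j v i ≡ Z i′ → viaZigzag b D j v (suc i) ≡ Z (suc i′) → ViaZigzagEdge i
      toVia : i ≡ j + j → viaZigzag b D j v i ≡ b + D → viaZigzag b D j v (suc i) ≡ v → ViaZigzagEdge i

    viaZigzagEdge : ∀ i → i < suc (j + j) → ViaZigzagEdge i
    viaZigzagEdge zero _ = fromVia refl refl (trans (viaZigzag-at 0 0<2j) (zigzag-first b D j 1≤j))
    viaZigzagEdge (suc i) 1+i<L with m≤n⇒m<n∨m≡n (≤-pred 1+i<L)
    ... | inj₁ 1+i<2j = along i refl 1+i<2j (viaZigzag-at i (<-trans (n<1+n i) 1+i<2j)) (viaZigzag-at (suc i) 1+i<2j)
    ... | inj₂ 1+i≡2j =
      toVia 1+i≡2j
        (trans (viaZigzag-at i (subst (i <_) 1+i≡2j (n<1+n i))) (trans (cong Z (cong (_∸ 1) 1+i≡2j)) (zigzag-last b D j 1≤j)))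
        (trans (cong (λ x → viaZigzag b D j v (suc x)) 1+i≡2j) (⟨⟩-at Z (j + j) toV))

    viaZigzag-closed : viaZigzag b D j v (suc (j + j)) ≡ viaZigzag b D j v 0
    viaZigzag-closed = ⟨⟩-at Z (j + j) toV

    viaZigzag-injective : j ≤ D → (∀ i → i < j + j → Z i ≢ v) →
      ∀ i i′ → i < suc (j + j) → i′ < suc (j + j) → viaZigzag b D j v i ≡ viaZigzag b D j v i′ → i ≡ i′
    viaZigzag-injective j≤D v-new zero zero _ _ _ = refl
    viaZigzag-injective j≤D v-new zero (suc i′) _ i′<L e = ⊥-elim (v-new i′ (≤-pred i′<L) (trans (sym (viaZigzag-at i′ (≤-pred i′<L))) (sym e)))
    viaZigzag-injective j≤D v-new (suc i) zero i<L _ e = ⊥-elim (v-new i (≤-pred i<L) (trans (sym (viaZigzag-at i (≤-pred i<L))) e))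
    viaZigzag-injective j≤D v-new (suc i) (suc i′) i<L i′<L e =
      cong suc (zigzag-injective b D j j≤D i i′ (≤-pred i<L) (≤-pred i′<L)
        (trans (sym (viaZigzag-at i (≤-pred i<L))) (trans e (viaZigzag-at i′ (≤-pred i′<L)))))

-- The strategy for m ≥ 3 and q ≥ 2

m≢m+n : ∀ m {n} → 1 ≤ n → m ≢ m + n
m≢m+n m (s≤s _) e = m+1+n≢m m (sym e)

SameEdge-fst : ∀ {a b u v} → SameEdge a b u v → a ≡ u ⊎ a ≡ v
SameEdge-fst (inj₁ (e , _)) = inj₁ e
SameEdge-fst (inj₂ (e , _)) = inj₂ e

SameEdge-snd : ∀ {a b u v} → SameEdge a b u v → b ≡ v ⊎ b ≡ u
SameEdge-snd (inj₁ (_ , e)) = inj₁ e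
SameEdge-snd (inj₂ (_ , e)) = inj₂ e

nearSpan-¬SameEdge : ∀ {D a q u v} → suc (suc q) ≤ D → NearSpan D u v → ¬ SameEdge a (a + q) u v
nearSpan-¬SameEdge {a = a} {q} 2+q≤D (d , inj₁ v≡u+d , D≤1+d , _) (inj₁ (refl , a+q≡v)) =
  <-irrefl (+-cancelˡ-≡ a q d (trans a+q≡v v≡u+d)) (≤-pred (≤-trans 2+q≤D D≤1+d))
nearSpan-¬SameEdge {a = a} {q} 2+q≤D (d , inj₂ u≡v+d , D≤1+d , _) (inj₂ (refl , a+q≡u)) =
  <-irrefl (+-cancelˡ-≡ a q d (trans a+q≡u u≡v+d)) (≤-pred (≤-trans 2+q≤D D≤1+d))
nearSpan-¬SameEdge {a = a} {q} 2+q≤D (d , inj₁ v≡u+d , D≤1+d , _) (inj₂ (a≡v , a+q≡u)) =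
  m≢m+n a (≤-trans (≤-pred (≤-trans (≤-trans (s≤s (s≤s z≤n)) 2+q≤D) D≤1+d)) (m≤n+m d q)) (trans a≡v (trans v≡u+d (trans (cong (_+ d) (sym a+q≡u)) (+-assoc a q d))))
nearSpan-¬SameEdge {a = a} {q} 2+q≤D (d , inj₂ u≡v+d , D≤1+d , _) (inj₁ (a≡u , a+q≡v)) =
  m≢m+n a (≤-trans (≤-pred (≤-trans (≤-trans (s≤s (s≤s z≤n)) 2+q≤D) D≤1+d)) (m≤n+m d q)) (trans a≡u (trans u≡v+d (trans (cong (_+ d) (sym a+q≡v)) (+-assoc a q d))))

nearSpan-fresh : ∀ N D a b → 3 ≤ D → NearSpan D a b → (a ≡ 0 → suc b < N) → (b ≡ 0 → suc a < N) →
  ¬ Selected (blueCycle N) a b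
nearSpan-fresh N D a b 3≤D (d , inj₁ b≡a+d , D≤1+d , _) notClosing _ s =
  ¬Selected-blueCycle-chord N a d (≤-pred (≤-trans 3≤D D≤1+d))
    (λ a≡0 → subst (λ x → suc x < N) b≡a+d (notClosing a≡0)) (subst (Selected (blueCycle N) a) b≡a+d s)
nearSpan-fresh N D a b 3≤D (d , inj₂ a≡b+d , D≤1+d , _) _ notClosing s =
  ¬Selected-blueCycle-chord N b d (≤-pred (≤-trans 3≤D D≤1+d))
    (λ b≡0 → subst (λ x → suc x < N) a≡b+d (notClosing b≡0)) (subst (Selected (blueCycle N) b) a≡b+d (Selected-sym s))

even⊎odd : ∀ k → Σ ℕ λ j → k ≡ j + j ⊎ k ≡ suc (j + j)
even⊎odd zero = 0 , inj₁ refl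
even⊎odd (suc k) with even⊎odd k
... | j , inj₁ k≡2j = j , inj₂ (cong suc k≡2j)
... | j , inj₂ k≡2j+1 = suc j , inj₁ (trans (cong suc k≡2j+1) (cong suc (sym (+-suc j j))))

j+j≤1+q+q⇒j≤q : ∀ {j q} → j + j ≤ suc (q + q) → j ≤ q
j+j≤1+q+q⇒j≤q {j} {q} 2j≤1+2q with j ≤? q
... | yes j≤q = j≤q
... | no j≰q = ⊥-elim (<-irrefl refl (≤-trans (s≤s (≤-reflexive (sym (+-suc q q)))) (≤-trans (+-mono-≤ q<j q<j) 2j≤1+2q)))
  where
  q<j : q < j
  q<j = ≰⇒> j≰q

3≤j+j⇒2≤j : ∀ j → 3 ≤ j + j → 2 ≤ j
3≤j+j⇒2≤j (suc (suc _)) _ = s≤s (s≤s z≤n)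
3≤j+j⇒2≤j 1 (s≤s (s≤s ()))

3≤1+j+j⇒1≤j : ∀ j → 3 ≤ suc (j + j) → 1 ≤ j
3≤1+j+j⇒1≤j (suc _) _ = s≤s z≤n
3≤1+j+j⇒1≤j 0 (s≤s ())

module Strategy (k m q : ℕ) (3≤m : 3 ≤ m) (2≤q : 2 ≤ q) where

  N : ℕ
  N = m + (q + q)

  End : Board → Set
  End = EndCk-Cm3 k m

  private
    1≤q : 1 ≤ q
    1≤q = ≤-trans (s≤s z≤n) 2≤q

    1≤m : 1 ≤ m
    1≤m = ≤-trans (s≤s z≤n) 3≤m

    m≢0 : m ≢ 0
    m≢0 = 2≤⇒≢0 (≤-trans (n≤1+n 2) 3≤m)

    m+q<N : m + q < N
    m+q<N = +-monoʳ-< m (m<m+n q 1≤q)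

    1+m+q<N : suc (m + q) < N
    1+m+q<N = ≤-trans (≤-reflexive (trans (cong suc (sym (+-suc m q))) (sym (+-suc m (suc q)))))
                      (+-monoʳ-≤ m (+-monoˡ-≤ q 2≤q))

    inner-ends : ∀ B a b → HamiltonCycleIn N B → NearSpan m a b → a < N → b < N → End ((a , b , blue) ∷ B)
    inner-ends B a b ham (d , inj₁ b≡a+d , m≤1+d , d≤1+m) _ b<N =
      innerChordEnds a d (HamiltonCycleIn-∷ _ ham) (≤-pred (≤-trans 3≤m m≤1+d)) m≤1+d
        (≤-trans (s≤s d≤1+m) (≤-reflexive (+-comm 2 m))) (subst (_< N) b≡a+d b<N)
        (subst (HasEdge _ blue a) b≡a+d HasEdge-here)
    inner-ends B a b ham (d , inj₂ a≡b+d , m≤1+d , d≤1+m) a<N _ =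
      innerChordEnds b d (HamiltonCycleIn-∷ _ ham) (≤-pred (≤-trans 3≤m m≤1+d)) m≤1+d
        (≤-trans (s≤s d≤1+m) (≤-reflexive (+-comm 2 m))) (subst (_< N) a≡b+d a<N)
        (subst (HasEdge _ blue b) a≡b+d (HasEdge-sym HasEdge-here))

    outerChord-ends : ∀ B lo d → HamiltonCycleIn N B → q + q ≤ suc d → d ≤ suc (q + q) →
      lo + d < N → HasEdge B blue lo (lo + d) → End B
    outerChord-ends B lo d ham 2q≤1+d d≤1+2q lo+d<N chord =
      outerChordEnds lo d ham (≤-trans (s≤s (s≤s d≤1+2q)) (+-monoˡ-≤ (q + q) 3≤m))
        (≤-pred (≤-trans (≤-trans 2≤q (m≤m+n q q)) 2q≤1+d)) lo+d<N
        (≤-trans (+-monoʳ-≤ m d≤1+2q) (≤-reflexive (+-suc m (q + q))))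
        (≤-trans (≤-reflexive (sym (+-suc m (q + q)))) (≤-trans (+-monoʳ-≤ m (s≤s 2q≤1+d)) (≤-reflexive (sym (+-assoc m 2 d)))))
        chord

    outer-ends : ∀ B a b → HamiltonCycleIn N B → NearSpan (q + q) a b → a < N → b < N → End ((a , b , blue) ∷ B)
    outer-ends B a b ham (d , inj₁ b≡a+d , 2q≤1+d , d≤1+2q) _ b<N =
      outerChord-ends _ a d (HamiltonCycleIn-∷ _ ham) 2q≤1+d d≤1+2q (subst (_< N) b≡a+d b<N)
        (subst (HasEdge _ blue a) b≡a+d HasEdge-here)
    outer-ends B a b ham (d , inj₂ a≡b+d , 2q≤1+d , d≤1+2q) a<N _ =
      outerChord-ends _ b d (HamiltonCycleIn-∷ _ ham) 2q≤1+d d≤1+2q (subst (_< N) a≡b+d a<N)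
        (subst (HasEdge _ blue b) a≡b+d (HasEdge-sym HasEdge-here))

    redCycle-ends : ∀ {L} → k ≡ L → ∀ B → ContainsCycle B red L → End B
    redCycle-ends k≡L B cycle = inj₁ (subst (ContainsCycle B red) (sym k≡L) cycle)

  module _ (j : ℕ) (k≡2j : k ≡ j + j) (2≤j : 2 ≤ j) (j≤q : j ≤ q) (q≤m : q ≤ m) where

    private
      1≤j : 1 ≤ j
      1≤j = ≤-trans (s≤s z≤n) 2≤j

      f : ℕ → ℕ
      f = closedZigzag 0 m j

      Spanning : ℕ → ℕ → Set
      Spanning u v = NearSpan m u v × u < m + j × v < m + j

      edge-spanning : ∀ i → i < j + j → Spanning (f i) (f (suc i))
      edge-spanning i i<2j with closedZigzagEdge 0 m j 1≤j i i<2j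
      ... | along 1+i<2j e e′ =
        subst₂ Spanning (sym e) (sym e′)
          (zigzag-nearSpan 0 m j i 1≤m 1+i<2j , zigzag-< 0 m j i i<2j , zigzag-< 0 m j (suc i) 1+i<2j)
      ... | back e e′ =
        subst₂ Spanning (sym e) (sym e′)
          ((m , inj₂ refl , n≤1+n m , n≤1+n _) , m<m+n m 1≤j , ≤-trans (s≤s z≤n) (m<m+n m 1≤j))

      m+j<N : m + j < N
      m+j<N = ≤-<-trans (+-monoʳ-≤ m j≤q) m+q<N

      fresh : ∀ i → i < j + j → ¬ Selected (blueCycle N) (f i) (f (suc i))
      fresh i i<2j with edge-spanning i i<2j
      ... | near , u< , v< = nearSpan-fresh N m _ _ 3≤m near (λ _ → ≤-<-trans v< m+j<N) (λ _ → ≤-<-trans u< m+j<N)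

      blue-ends : ∀ i → i < j + j → ∀ B → HamiltonCycleIn N B → End ((f i , f (suc i) , blue) ∷ B)
      blue-ends i i<2j B ham with edge-spanning i i<2j
      ... | near , u< , v< = inner-ends B _ _ ham near (<-trans u< m+j<N) (<-trans v< m+j<N)

    evenCycle-wins : BuilderWinsWithin End (k + 1) (blueCycle N)
    evenCycle-wins =
      winsWithin-mono (≤-trans (≤-reflexive (sym k≡2j)) (m≤m+n k 1))
        (drawRedCycle-wins N (j + j) f (≤-trans (s≤s (s≤s (s≤s (z≤n {1})))) (+-mono-≤ 2≤j 2≤j))
          (closedZigzag-injective 0 m j 1≤j (≤-trans j≤q q≤m)) (closedZigzag-closed 0 m j 1≤j)
          fresh blue-ends (redCycle-ends k≡2j))

  module _ (j : ℕ) (k≡2j+1 : k ≡ suc (j + j)) (1≤j : 1 ≤ j) (j≤q : j ≤ q) (q≤m : q ≤ m) (m≤1+q : m ≤ suc q) where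

    private
      f : ℕ → ℕ
      f = zigzagVia 0 m j (m + q)

      below-m+q : ∀ i → i < j + j → zigzag 0 m j i < m + q
      below-m+q i i<2j = <-≤-trans (zigzag-< 0 m j i i<2j) (+-monoʳ-≤ m j≤q)

      fresh : ∀ i → i < suc (j + j) → ¬ Selected (blueCycle N) (f i) (f (suc i))
      fresh i i<L with zigzagViaEdge 0 m j 1≤j (m + q) i i<L
      ... | along 1+i<2j e e′ =
        subst₂ (λ u v → ¬ Selected (blueCycle N) u v) (sym e) (sym e′)
          (nearSpan-fresh N m _ _ 3≤m (zigzag-nearSpan 0 m j i 1≤m 1+i<2j)
            (λ _ → ≤-<-trans (below-m+q (suc i) 1+i<2j) m+q<N)
            (λ _ → ≤-<-trans (below-m+q i (<-trans (n<1+n i) 1+i<2j)) m+q<N))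
      ... | toVia _ e e′ =
        subst₂ (λ u v → ¬ Selected (blueCycle N) u v) (sym e) (sym e′)
          (¬Selected-blueCycle-chord N m q 2≤q (λ m≡0 → ⊥-elim (m≢0 m≡0)))
      ... | fromVia _ e e′ =
        subst₂ (λ u v → ¬ Selected (blueCycle N) u v) (sym e) (sym e′)
          (λ s → ¬Selected-blueCycle-chord N 0 (m + q) (≤-trans 2≤q (m≤n+m q m)) (λ _ → 1+m+q<N) (Selected-sym s))

      blue-ends : ∀ i → i < suc (j + j) → ∀ B → HamiltonCycleIn N B → End ((f i , f (suc i) , blue) ∷ B)
      blue-ends i i<L B ham with zigzagViaEdge 0 m j 1≤j (m + q) i i<L
      ... | along 1+i<2j e e′ =
        subst₂ (λ u v → End ((u , v , blue) ∷ B)) (sym e) (sym e′)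
          (inner-ends B _ _ ham (zigzag-nearSpan 0 m j i 1≤m 1+i<2j)
            (<-trans (below-m+q i (<-trans (n<1+n i) 1+i<2j)) m+q<N) (<-trans (below-m+q (suc i) 1+i<2j) m+q<N))
      ... | toVia _ e e′ =
        subst₂ (λ u v → End ((u , v , blue) ∷ B)) (sym e) (sym e′)
          (innerChordEnds m q (HamiltonCycleIn-∷ _ ham) 2≤q m≤1+q
            (≤-trans (s≤s q≤m) (≤-trans (n≤1+n _) (≤-reflexive (+-comm 2 m)))) m+q<N HasEdge-here)
      ... | fromVia _ e e′ =
        subst₂ (λ u v → End ((u , v , blue) ∷ B)) (sym e) (sym e′)
          (outerChordEnds 0 (m + q) (HamiltonCycleIn-∷ _ ham) 1+m+q<N (≤-trans 1≤q (m≤n+m q m)) m+q<N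
            (≤-trans (+-monoʳ-≤ m (+-monoˡ-≤ q m≤1+q)) (≤-reflexive (+-suc m (q + q))))
            (≤-trans (≤-reflexive (sym (+-suc m (q + q))))
              (≤-trans (+-monoʳ-≤ m (+-monoˡ-≤ q (≤-trans (s≤s q≤m) (n≤1+n _)))) (≤-reflexive (twoChords m q))))
            (HasEdge-sym HasEdge-here))
        where
        twoChords : ∀ m q → m + (suc (suc m) + q) ≡ m + 2 + (m + q)
        twoChords = solve-∀

    shortOddCycle-wins : BuilderWinsWithin End (k + 1) (blueCycle N)
    shortOddCycle-wins =
      winsWithin-mono (≤-trans (≤-reflexive (sym k≡2j+1)) (m≤m+n k 1))
        (drawRedCycle-wins N (suc (j + j)) f (s≤s (+-mono-≤ 1≤j 1≤j))
          (zigzagVia-injective 0 m j 1≤j (m + q) (≤-trans j≤q q≤m) (λ i i<2j e → <-irrefl e (below-m+q i i<2j)))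
          (zigzagVia-closed 0 m j 1≤j (m + q)) fresh blue-ends (redCycle-ends k≡2j+1))

  module _ (j : ℕ) (k≡2j+1 : k ≡ suc (j + j)) (1≤j : 1 ≤ j) (j≤q : j ≤ q) (2+q≤m : suc (suc q) ≤ m) where

    private
      q<m : q < m
      q<m = ≤-trans (n≤1+n _) 2+q≤m

      q≤m : q ≤ m
      q≤m = <⇒≤ q<m

      L : ℕ
      L = suc (j + j)

      3≤L : 3 ≤ L
      3≤L = s≤s (+-mono-≤ 1≤j 1≤j)

      BlueChord BlueBack : Board
      BlueChord = (m , m + q , blue) ∷ blueCycle N
      BlueBack = (m + q , 0 , blue) ∷ (m , m + q , red) ∷ blueCycle N

      -- Painter coloured {m, m+q} blue: the cycle is the zigzag from q to q + m, closed through 0.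
      module ChordBlue where
        f : ℕ → ℕ
        f = zigzagVia q m j 0

        Good : Board → Set
        Good B = HamiltonCycleIn N B × HasEdge B blue m (m + q)

        zigzag-≢0 : ∀ i → zigzag q m j i ≢ 0
        zigzag-≢0 i = 2≤⇒≢0 (≤-trans 2≤q (zigzag-≥ q m j i))

        zigzag<N : ∀ i → i < j + j → zigzag q m j i < N
        zigzag<N i i<2j = <-≤-trans (zigzag-< q m j i i<2j)
          (≤-trans (+-monoʳ-≤ (q + m) j≤q) (≤-reflexive (trans (cong (_+ q) (+-comm q m)) (+-assoc m q q))))

        fresh : ∀ i → i < L → ¬ Selected BlueChord (f i) (f (suc i))
        fresh i i<L s with zigzagViaEdge q m j 1≤j 0 i i<L
        ... | along 1+i<2j e e′ with Selected-∷⁻ (subst₂ (Selected BlueChord) e e′ s)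
        ...   | inj₁ same = nearSpan-¬SameEdge 2+q≤m (zigzag-nearSpan q m j i 1≤m 1+i<2j) same
        ...   | inj₂ old = nearSpan-fresh N m _ _ 3≤m (zigzag-nearSpan q m j i 1≤m 1+i<2j)
                             (λ e₀ → ⊥-elim (zigzag-≢0 i e₀)) (λ e₀ → ⊥-elim (zigzag-≢0 (suc i) e₀)) old
        fresh i i<L s | toVia _ e e′ with Selected-∷⁻ (subst₂ (Selected BlueChord) e e′ s)
        ...   | inj₁ same with SameEdge-fst same
        ...     | inj₁ m≡q+m = m≢m+n m 1≤q (trans m≡q+m (+-comm q m))
        ...     | inj₂ m≡0 = m≢0 m≡0
        fresh i i<L s | toVia _ e e′ | inj₂ old =
          ¬Selected-blueCycle-chord N 0 (q + m) (≤-trans 2≤q (m≤m+n q m))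
            (λ _ → subst (λ x → suc x < N) (+-comm m q) 1+m+q<N) (Selected-sym old)
        fresh i i<L s | fromVia _ e e′ with Selected-∷⁻ (subst₂ (Selected BlueChord) e e′ s)
        ...   | inj₁ same with SameEdge-fst same
        ...     | inj₁ m≡0 = m≢0 m≡0
        ...     | inj₂ m≡q = <-irrefl (sym m≡q) q<m
        fresh i i<L s | fromVia _ e e′ | inj₂ old =
          ¬Selected-blueCycle-chord N 0 q 2≤q (λ _ → ≤-<-trans (s≤s (m≤n+m q m)) 1+m+q<N) old

        blue-ends : ∀ i → i < L → ∀ B → Good B → End ((f i , f (suc i) , blue) ∷ B)
        blue-ends i i<L B (ham , chord) with zigzagViaEdge q m j 1≤j 0 i i<L
        ... | along 1+i<2j e e′ =
          subst₂ (λ u v → End ((u , v , blue) ∷ B)) (sym e) (sym e′)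
            (inner-ends B _ _ ham (zigzag-nearSpan q m j i 1≤m 1+i<2j)
              (zigzag<N i (<-trans (n<1+n i) 1+i<2j)) (zigzag<N (suc i) 1+i<2j))
        ... | toVia _ e e′ =
          subst₂ (λ u v → End ((u , v , blue) ∷ B)) (sym e) (sym e′)
            (chords[m,m+q][m+q,0]-end {k} {m} {q} (HamiltonCycleIn-∷ _ ham) 1≤q 1≤m (there chord)
              (subst (λ x → HasEdge ((q + m , 0 , blue) ∷ B) blue x 0) (+-comm q m) HasEdge-here))
        ... | fromVia _ e e′ =
          subst₂ (λ u v → End ((u , v , blue) ∷ B)) (sym e) (sym e′)
            (chords[m,m+q][0,q]-end {k} {m} {q} (HamiltonCycleIn-∷ _ ham) 1≤q q≤m (there chord) HasEdge-here)

        open RedCycleStrategy End Good (λ _ _ (ham , chord) → HamiltonCycleIn-∷ _ ham , there chord) L L f ≤-refl 3≤L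
          (zigzagVia-injective q m j 1≤j 0 (≤-trans j≤q q≤m) (λ i _ → zigzag-≢0 i)) (zigzagVia-closed q m j 1≤j 0)
          BlueChord fresh blue-ends (λ i L≤i i<L → ⊥-elim (<⇒≱ i<L L≤i))
          (HamiltonCycleIn-∷ _ (blueCycle-hamiltonian N) , HasEdge-here) (redCycle-ends k≡2j+1) public

      -- Painter coloured {m, m+q} red and {m+q, 0} blue: the cycle runs from m through the
      -- zigzag from m - q to m + q, and its last edge {m+q, m} is already red.
      module BackBlue where
        lower : ℕ
        lower = m ∸ q

        f : ℕ → ℕ
        f = viaZigzag lower (q + q) j m

        Good : Board → Set
        Good B = HamiltonCycleIn N B × HasEdge B blue (m + q) 0

        lower+q≡m : lower + q ≡ m
        lower+q≡m = m∸n+n≡m q≤m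

        top≡m+q : lower + (q + q) ≡ m + q
        top≡m+q = trans (sym (+-assoc lower q q)) (cong (_+ q) lower+q≡m)

        2≤lower : 2 ≤ lower
        2≤lower = subst (_≤ lower) (m+n∸n≡m 2 q) (∸-monoˡ-≤ q 2+q≤m)

        3≤2q : 3 ≤ q + q
        3≤2q = ≤-trans (s≤s (s≤s (s≤s (z≤n {1})))) (+-mono-≤ 2≤q 2≤q)

        zigzag-≢0 : ∀ i → zigzag lower (q + q) j i ≢ 0
        zigzag-≢0 i = 2≤⇒≢0 (≤-trans 2≤lower (zigzag-≥ lower (q + q) j i))

        zigzag<N : ∀ i → i < j + j → zigzag lower (q + q) j i < N
        zigzag<N i i<2j = <-≤-trans (zigzag-< lower (q + q) j i i<2j)
          (≤-trans (+-monoʳ-≤ (lower + (q + q)) j≤q) (≤-reflexive (trans (cong (_+ q) top≡m+q) (+-assoc m q q))))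

        zigzag-≢m : ∀ i → i < j + j → zigzag lower (q + q) j i ≢ m
        zigzag-≢m i i<2j e with zigzag-lower⊎upper lower (q + q) j i i<2j
        ... | inj₁ below = <-irrefl e (<-≤-trans below (≤-trans (+-monoʳ-≤ lower j≤q) (≤-reflexive lower+q≡m)))
        ... | inj₂ (above , _) =
          m≢m+n m 1≤q (sym (≤-antisym (≤-trans (≤-reflexive (sym top≡m+q)) (≤-trans above (≤-reflexive e))) (m≤m+n m q)))

        near : ∀ i → suc i < j + j → NearSpan (q + q) (zigzag lower (q + q) j i) (zigzag lower (q + q) j (suc i))
        near i = zigzag-nearSpan lower (q + q) j i (≤-trans (s≤s z≤n) 3≤2q)

        fresh : ∀ i → i < j + j → ¬ Selected BlueBack (f i) (f (suc i))
        fresh i i<2j s with viaZigzagEdge lower (q + q) j 1≤j m i (<-trans i<2j (n<1+n _))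
        ... | toVia i≡2j _ _ = <-irrefl i≡2j i<2j
        ... | fromVia _ e e′ with Selected-∷⁻ (subst₂ (Selected BlueBack) e e′ s)
        ...   | inj₁ same with SameEdge-snd same
        ...     | inj₁ 0≡lower = 2≤⇒≢0 2≤lower (sym 0≡lower)
        ...     | inj₂ 0≡m = m≢0 (sym 0≡m)
        fresh i i<2j s | fromVia _ e e′ | inj₂ s′ with Selected-∷⁻ s′
        ...   | inj₁ same with SameEdge-snd same
        ...     | inj₁ m+q≡lower = <-irrefl (sym m+q≡lower) (≤-<-trans (m∸n≤m m q) (m<m+n m 1≤q))
        ...     | inj₂ m+q≡m = m≢m+n m 1≤q (sym m+q≡m)
        fresh i i<2j s | fromVia _ e e′ | inj₂ s′ | inj₂ old =
          ¬Selected-blueCycle-chord N lower q 2≤q (λ lower≡0 → ⊥-elim (2≤⇒≢0 2≤lower lower≡0))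
            (subst (Selected (blueCycle N) lower) (sym lower+q≡m) (Selected-sym old))
        fresh i i<2j s | along i′ refl 1+i′<2j e e′ with Selected-∷⁻ (subst₂ (Selected BlueBack) e e′ s)
        ...   | inj₁ same with SameEdge-snd same
        ...     | inj₁ 0≡v = zigzag-≢0 (suc i′) (sym 0≡v)
        ...     | inj₂ 0≡u = zigzag-≢0 i′ (sym 0≡u)
        fresh i i<2j s | along i′ refl 1+i′<2j e e′ | inj₂ s′ with Selected-∷⁻ s′
        ...   | inj₁ same with SameEdge-fst same
        ...     | inj₁ m≡u = zigzag-≢m i′ (<-trans (n<1+n i′) 1+i′<2j) (sym m≡u)
        ...     | inj₂ m≡v = zigzag-≢m (suc i′) 1+i′<2j (sym m≡v)
        fresh i i<2j s | along i′ refl 1+i′<2j e e′ | inj₂ s′ | inj₂ old =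
          nearSpan-fresh N (q + q) _ _ 3≤2q (near i′ 1+i′<2j)
            (λ e₀ → ⊥-elim (zigzag-≢0 i′ e₀)) (λ e₀ → ⊥-elim (zigzag-≢0 (suc i′) e₀)) old

        blue-ends : ∀ i → i < j + j → ∀ B → Good B → End ((f i , f (suc i) , blue) ∷ B)
        blue-ends i i<2j B (ham , backChord) with viaZigzagEdge lower (q + q) j 1≤j m i (<-trans i<2j (n<1+n _))
        ... | toVia i≡2j _ _ = ⊥-elim (<-irrefl i≡2j i<2j)
        ... | fromVia _ e e′ =
          subst₂ (λ u v → End ((u , v , blue) ∷ B)) (sym e) (sym e′)
            (chords[m∸q,m][m+q,0]-end {k} {m} {q} (HamiltonCycleIn-∷ _ ham) 1≤q q<m (HasEdge-sym HasEdge-here) (there backChord))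
        ... | along i′ refl 1+i′<2j e e′ =
          subst₂ (λ u v → End ((u , v , blue) ∷ B)) (sym e) (sym e′)
            (outer-ends B _ _ ham (near i′ 1+i′<2j) (zigzag<N i′ (<-trans (n<1+n i′) 1+i′<2j)) (zigzag<N (suc i′) 1+i′<2j))

        red-already : ∀ i → j + j ≤ i → i < L → HasEdge BlueBack red (f i) (f (suc i))
        red-already i 2j≤i i<L with viaZigzagEdge lower (q + q) j 1≤j m i i<L
        ... | toVia _ e e′ = subst₂ (HasEdge BlueBack red) (sym e) (sym e′) (there (here (refl , inj₂ (refl , sym top≡m+q))))
        ... | fromVia refl _ _ = ⊥-elim (<⇒≱ (≤-trans (s≤s z≤n) (+-mono-≤ 1≤j 1≤j)) 2j≤i)
        ... | along i′ refl 1+i′<2j _ _ = ⊥-elim (<⇒≱ 1+i′<2j 2j≤i)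

        open RedCycleStrategy End Good (λ _ _ (ham , backChord) → HamiltonCycleIn-∷ _ ham , there backChord) L (j + j) f (n≤1+n _) 3≤L
          (viaZigzag-injective lower (q + q) j 1≤j m (≤-trans j≤q (m≤m+n q q)) zigzag-≢m) (viaZigzag-closed lower (q + q) j 1≤j m)
          BlueBack fresh blue-ends red-already
          (HamiltonCycleIn-∷ _ (HamiltonCycleIn-∷ _ (blueCycle-hamiltonian N)) , HasEdge-here) (redCycle-ends k≡2j+1) public

      -- Painter coloured both {m, m+q} and {m+q, 0} red: they are the last two edges of the
      -- zigzag from 0 to m closed through m + q.
      module BothRed where
        f : ℕ → ℕ
        f = zigzagVia 0 m j (m + q)

        BothRedBoard : Board
        BothRedBoard = (m + q , 0 , red) ∷ (m , m + q , red) ∷ blueCycle N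

        s : ℕ
        s = j + j ∸ 1

        1+s≡2j : suc s ≡ j + j
        1+s≡2j = suc-∸1 (≤-trans 1≤j (m≤m+n j j))

        below-m+q : ∀ i → i < j + j → zigzag 0 m j i < m + q
        below-m+q i i<2j = <-≤-trans (zigzag-< 0 m j i i<2j) (+-monoʳ-≤ m j≤q)

        zigzag-≢m+q : ∀ i → i < j + j → zigzag 0 m j i ≢ m + q
        zigzag-≢m+q i i<2j e = <-irrefl e (below-m+q i i<2j)

        fresh : ∀ i → i < s → ¬ Selected BothRedBoard (f i) (f (suc i))
        fresh i i<s sel with zigzagViaEdge 0 m j 1≤j (m + q) i (<-trans i<s (≤-trans (≤-reflexive 1+s≡2j) (n≤1+n _)))
        ... | toVia 1+i≡2j _ _ = <-irrefl (trans 1+i≡2j (sym 1+s≡2j)) (s≤s i<s)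
        ... | fromVia i≡2j _ _ = <-irrefl (trans i≡2j (sym 1+s≡2j)) (<-trans i<s (n<1+n s))
        ... | along 1+i<2j e e′ with Selected-∷⁻ (subst₂ (Selected BothRedBoard) e e′ sel)
        ...   | inj₁ same with SameEdge-fst same
        ...     | inj₁ m+q≡u = zigzag-≢m+q i (<-trans (n<1+n i) 1+i<2j) (sym m+q≡u)
        ...     | inj₂ m+q≡v = zigzag-≢m+q (suc i) 1+i<2j (sym m+q≡v)
        fresh i i<s sel | along 1+i<2j e e′ | inj₂ sel′ with Selected-∷⁻ sel′
        ...   | inj₁ same with SameEdge-snd same
        ...     | inj₁ m+q≡v = zigzag-≢m+q (suc i) 1+i<2j (sym m+q≡v)
        ...     | inj₂ m+q≡u = zigzag-≢m+q i (<-trans (n<1+n i) 1+i<2j) (sym m+q≡u)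
        fresh i i<s sel | along 1+i<2j e e′ | inj₂ sel′ | inj₂ old =
          nearSpan-fresh N m _ _ 3≤m (zigzag-nearSpan 0 m j i 1≤m 1+i<2j)
            (λ _ → ≤-<-trans (below-m+q (suc i) 1+i<2j) m+q<N)
            (λ _ → ≤-<-trans (below-m+q i (<-trans (n<1+n i) 1+i<2j)) m+q<N) old

        blue-ends : ∀ i → i < s → ∀ B → HamiltonCycleIn N B → End ((f i , f (suc i) , blue) ∷ B)
        blue-ends i i<s B ham with zigzagViaEdge 0 m j 1≤j (m + q) i (<-trans i<s (≤-trans (≤-reflexive 1+s≡2j) (n≤1+n _)))
        ... | toVia 1+i≡2j _ _ = ⊥-elim (<-irrefl (trans 1+i≡2j (sym 1+s≡2j)) (s≤s i<s))
        ... | fromVia i≡2j _ _ = ⊥-elim (<-irrefl (trans i≡2j (sym 1+s≡2j)) (<-trans i<s (n<1+n s)))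
        ... | along 1+i<2j e e′ =
          subst₂ (λ u v → End ((u , v , blue) ∷ B)) (sym e) (sym e′)
            (inner-ends B _ _ ham (zigzag-nearSpan 0 m j i 1≤m 1+i<2j)
              (<-trans (below-m+q i (<-trans (n<1+n i) 1+i<2j)) m+q<N) (<-trans (below-m+q (suc i) 1+i<2j) m+q<N))

        red-already : ∀ i → s ≤ i → i < L → HasEdge BothRedBoard red (f i) (f (suc i))
        red-already i s≤i i<L with zigzagViaEdge 0 m j 1≤j (m + q) i i<L
        ... | toVia _ e e′ = subst₂ (HasEdge BothRedBoard red) (sym e) (sym e′) (there HasEdge-here)
        ... | fromVia _ e e′ = subst₂ (HasEdge BothRedBoard red) (sym e) (sym e′) HasEdge-here
        ... | along 1+i<2j _ _ = ⊥-elim (<-irrefl refl (≤-trans 1+i<2j (≤-trans (≤-reflexive (sym 1+s≡2j)) (s≤s s≤i))))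

        open RedCycleStrategy End (HamiltonCycleIn N) (λ _ _ → HamiltonCycleIn-∷ _) L s f (≤-trans (m∸n≤m (j + j) 1) (n≤1+n _)) 3≤L
          (zigzagVia-injective 0 m j 1≤j (m + q) (≤-trans j≤q q≤m) zigzag-≢m+q) (zigzagVia-closed 0 m j 1≤j (m + q))
          BothRedBoard fresh blue-ends red-already
          (HamiltonCycleIn-∷ _ (HamiltonCycleIn-∷ _ (blueCycle-hamiltonian N))) (redCycle-ends k≡2j+1) public

      backFresh : ¬ Selected ((m , m + q , red) ∷ blueCycle N) (m + q) 0
      backFresh sel with Selected-∷⁻ sel
      ... | inj₁ same with SameEdge-fst same
      ...   | inj₁ m≡m+q = m≢m+n m 1≤q m≡m+q
      ...   | inj₂ m≡0 = m≢0 m≡0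
      backFresh sel | inj₂ old =
        ¬Selected-blueCycle-chord N 0 (m + q) (≤-trans 2≤q (m≤n+m q m)) (λ _ → 1+m+q<N) (Selected-sym old)

    longOddCycle-wins : BuilderWinsWithin End (k + 1) (blueCycle N)
    longOddCycle-wins =
      subst (λ t → BuilderWinsWithin End t (blueCycle N)) (trans (cong suc (sym k≡2j+1)) (+-comm 1 k))
        (inj₂ (m , m + q , m≢m+n m 1≤q , ¬Selected-blueCycle-chord N m q 2≤q (λ m≡0 → ⊥-elim (m≢0 m≡0)) ,
          λ { blue → ChordBlue.wins
            ; red → inj₂ (m + q , 0 , 2≤⇒≢0 (≤-trans 2≤q (m≤n+m q m)) , backFresh ,
                λ { blue → BackBlue.wins
                  ; red → winsWithin-mono (m∸n≤m (j + j) 1) BothRed.wins }) }))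

  oddCycle-wins : ∀ j → k ≡ suc (j + j) → 1 ≤ j → j ≤ q → q ≤ m → BuilderWinsWithin End (k + 1) (blueCycle N)
  oddCycle-wins j k≡2j+1 1≤j j≤q q≤m with m ≤? suc q
  ... | yes m≤1+q = shortOddCycle-wins j k≡2j+1 1≤j j≤q q≤m m≤1+q
  ... | no m≰1+q = longOddCycle-wins j k≡2j+1 1≤j j≤q (≰⇒> m≰1+q)

  wins : 3 ≤ k → k ≤ suc (q + q) → q ≤ m → BuilderWinsWithin End (k + 1) (blueCycle N)
  wins 3≤k k≤1+2q q≤m with even⊎odd k
  ... | j , inj₁ k≡2j =
    evenCycle-wins j k≡2j (3≤j+j⇒2≤j j (subst (3 ≤_) k≡2j 3≤k))
      (j+j≤1+q+q⇒j≤q (subst (_≤ suc (q + q)) k≡2j k≤1+2q)) q≤m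
  ... | j , inj₂ k≡2j+1 =
    oddCycle-wins j k≡2j+1 (3≤1+j+j⇒1≤j j (subst (3 ≤_) k≡2j+1 3≤k))
      (j+j≤1+q+q⇒j≤q (≤-trans (n≤1+n _) (subst (_≤ suc (q + q)) k≡2j+1 k≤1+2q))) q≤m

-- The hexagon and the reduction

leftInverse⇒injective : ∀ {L} (f g : ℕ → ℕ) → (∀ i → i < L → g (f i) ≡ i) →
  ∀ i j → i < L → j < L → f i ≡ f j → i ≡ j
leftInverse⇒injective f g g∘f i j i<L j<L e = trans (sym (g∘f i i<L)) (trans (cong g e) (g∘f j j<L))

≤-decide : ∀ a b → {True (a ≤? b)} → a ≤ b
≤-decide a b {a≤b} = toWitness a≤b

hexagon-triangle-wins : BuilderWinsWithin (EndCk-Cm3 3 2) 4 (blueCycle 6)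
hexagon-triangle-wins =
  winsWithin-suc {EndCk-Cm3 3 2} 3
    (drawRedCycle-wins {EndCk-Cm3 3 2} 6 3 f ≤-refl (leftInverse⇒injective f g g∘f) refl fresh blue-ends (λ _ → inj₁))
  where
  f : ℕ → ℕ
  f 1 = 2
  f 2 = 4
  f _ = 0
  g : ℕ → ℕ
  g 2 = 1
  g 4 = 2
  g _ = 0
  g∘f : ∀ i → i < 3 → g (f i) ≡ i
  g∘f 0 _ = refl
  g∘f 1 _ = refl
  g∘f 2 _ = refl
  g∘f (suc (suc (suc _))) (s≤s (s≤s (s≤s ())))
  fresh : ∀ i → i < 3 → ¬ Selected (blueCycle 6) (f i) (f (suc i))
  fresh 0 _ = ¬Selected-blueCycle-chord 6 0 2 ≤-refl (λ _ → ≤-decide 4 6)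
  fresh 1 _ = ¬Selected-blueCycle-chord 6 2 2 ≤-refl (λ ())
  fresh 2 _ = λ s → ¬Selected-blueCycle-chord 6 0 4 (≤-decide 2 4) (λ _ → ≤-refl) (Selected-sym s)
  fresh (suc (suc (suc _))) (s≤s (s≤s (s≤s ())))
  blue-ends : ∀ i → i < 3 → ∀ B → HamiltonCycleIn 6 B → EndCk-Cm3 3 2 ((f i , f (suc i) , blue) ∷ B)
  blue-ends 0 _ B ham = innerChordEnds 0 2 (HamiltonCycleIn-∷ _ ham) ≤-refl (≤-decide 2 3) (≤-decide 3 4) (≤-decide 3 6) HasEdge-here
  blue-ends 1 _ B ham = innerChordEnds 2 2 (HamiltonCycleIn-∷ _ ham) ≤-refl (≤-decide 2 3) (≤-decide 3 4) (≤-decide 5 6) HasEdge-here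
  blue-ends 2 _ B ham =
    outerChordEnds 0 4 (HamiltonCycleIn-∷ _ ham) ≤-refl (≤-decide 1 4) (≤-decide 5 6) (≤-decide 6 7) (≤-decide 7 8)
      (HasEdge-sym HasEdge-here)
  blue-ends (suc (suc (suc _))) (s≤s (s≤s (s≤s ())))

hexagon-square-wins : BuilderWinsWithin (EndCk-Cm3 4 2) 5 (blueCycle 6)
hexagon-square-wins =
  winsWithin-suc {EndCk-Cm3 4 2} 4
    (drawRedCycle-wins {EndCk-Cm3 4 2} 6 4 f (≤-decide 3 4) (leftInverse⇒injective f g g∘f) refl fresh blue-ends (λ _ → inj₁))
  where
  f : ℕ → ℕ
  f 1 = 2
  f 2 = 5
  f 3 = 3
  f _ = 0
  g : ℕ → ℕ
  g 2 = 1
  g 5 = 2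
  g 3 = 3
  g _ = 0
  g∘f : ∀ i → i < 4 → g (f i) ≡ i
  g∘f 0 _ = refl
  g∘f 1 _ = refl
  g∘f 2 _ = refl
  g∘f 3 _ = refl
  g∘f (suc (suc (suc (suc _)))) (s≤s (s≤s (s≤s (s≤s ()))))
  fresh : ∀ i → i < 4 → ¬ Selected (blueCycle 6) (f i) (f (suc i))
  fresh 0 _ = ¬Selected-blueCycle-chord 6 0 2 ≤-refl (λ _ → ≤-decide 4 6)
  fresh 1 _ = ¬Selected-blueCycle-chord 6 2 3 (≤-decide 2 3) (λ ())
  fresh 2 _ = λ s → ¬Selected-blueCycle-chord 6 3 2 ≤-refl (λ ()) (Selected-sym s)
  fresh 3 _ = λ s → ¬Selected-blueCycle-chord 6 0 3 (≤-decide 2 3) (λ _ → ≤-decide 5 6) (Selected-sym s)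
  fresh (suc (suc (suc (suc _)))) (s≤s (s≤s (s≤s (s≤s ()))))
  blue-ends : ∀ i → i < 4 → ∀ B → HamiltonCycleIn 6 B → EndCk-Cm3 4 2 ((f i , f (suc i) , blue) ∷ B)
  blue-ends 0 _ B ham = innerChordEnds 0 2 (HamiltonCycleIn-∷ _ ham) ≤-refl (≤-decide 2 3) (≤-decide 3 4) (≤-decide 3 6) HasEdge-here
  blue-ends 1 _ B ham = innerChordEnds 2 3 (HamiltonCycleIn-∷ _ ham) (≤-decide 2 3) (≤-decide 2 4) ≤-refl (≤-decide 6 6) HasEdge-here
  blue-ends 2 _ B ham =
    innerChordEnds 3 2 (HamiltonCycleIn-∷ _ ham) ≤-refl (≤-decide 2 3) (≤-decide 3 4) (≤-decide 6 6) (HasEdge-sym HasEdge-here)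
  blue-ends 3 _ B ham =
    innerChordEnds 0 3 (HamiltonCycleIn-∷ _ ham) (≤-decide 2 3) (≤-decide 2 4) ≤-refl (≤-decide 4 6) (HasEdge-sym HasEdge-here)
  blue-ends (suc (suc (suc (suc _)))) (s≤s (s≤s (s≤s (s≤s ()))))

hexagon-wins : ∀ k → 3 ≤ k → k ≤ 4 → BuilderWinsWithin (EndCk-Cm3 k 2) (k + 1) (blueCycle 6)
hexagon-wins 3 _ _ = hexagon-triangle-wins
hexagon-wins 4 _ _ = hexagon-square-wins
hexagon-wins (suc (suc (suc (suc (suc _))))) _ (s≤s (s≤s (s≤s (s≤s ()))))
hexagon-wins 1 (s≤s ()) _
hexagon-wins 2 (s≤s (s≤s ())) _

builderWins : ∀ k m q → 3 ≤ k → 2 ≤ m → 1 ≤ q → q ≤ m → k ≤ suc (q + q) → (m ≡ 2 → k ≤ q + q) →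
  BuilderWinsWithin (EndCk-Cm3 k m) (k + 1) (blueCycle (m + (q + q)))
builderWins k m 1 _ 2≤m _ _ _ _ =
  winsWithin-end (k + 1) (hamiltonCycle-end (≤-trans (s≤s z≤n) 2≤m) (blueCycle-hamiltonian (m + 2)))
builderWins k m q@(suc (suc _)) 3≤k 2≤m _ q≤m k≤1+2q m≡2⇒k≤2q with m ≟ 2
... | no m≢2 = Strategy.wins k m q (≤∧≢⇒< 2≤m (m≢2 ∘ sym)) (s≤s (s≤s z≤n)) 3≤k k≤1+2q q≤m
... | yes refl with q≤m
...   | s≤s (s≤s z≤n) = hexagon-wins k 3≤k (m≡2⇒k≤2q refl)

halving : ∀ h → h ≡ h / 2 + h / 2 + h % 2
halving h = trans (m≡m%n+[m/n]*n h 2) (reorder (h % 2) (h / 2))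
  where
  reorder : ∀ r q → r + q * 2 ≡ q + q + r
  reorder = solve-∀

3≤2*n⇒2≤n : ∀ n → 3 ≤ 2 * n → 2 ≤ n
3≤2*n⇒2≤n (suc (suc _)) _ = s≤s (s≤s z≤n)
3≤2*n⇒2≤n 1 (s≤s (s≤s ()))

lemma5 : (k n h : ℕ) → 3 ≤ k → 1 ≤ n → k ≤ h → h ≤ 2 * n →
    BuilderWinsWithin (EndCk-Cm3 k (n + parity h)) (k + 1) (blueCycle (n + h))
lemma5 k n h 3≤k _ k≤h h≤2n =
  subst (λ N → BuilderWinsWithin (EndCk-Cm3 k (n + r)) (k + 1) (blueCycle N)) (sym n+h≡N)
    (builderWins k (n + r) q 3≤k (≤-trans 2≤n (m≤m+n n r)) 1≤q (≤-trans q≤n (m≤m+n n r)) k≤1+2q n+r≡2⇒k≤2q)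
  where
  r q : ℕ
  r = parity h
  q = h / 2
  r≤1 : r ≤ 1
  r≤1 = ≤-pred (m%n<n h 2)
  k≤2q+r : k ≤ q + q + r
  k≤2q+r = subst (k ≤_) (halving h) k≤h
  k≤1+2q : k ≤ suc (q + q)
  k≤1+2q = ≤-trans k≤2q+r (≤-trans (+-monoʳ-≤ (q + q) r≤1) (≤-reflexive (+-comm (q + q) 1)))
  2≤n : 2 ≤ n
  2≤n = 3≤2*n⇒2≤n n (≤-trans 3≤k (≤-trans k≤h h≤2n))
  1≤q : 1 ≤ q
  1≤q = 3≤1+j+j⇒1≤j q (≤-trans 3≤k k≤1+2q)
  q≤n : q ≤ n
  q≤n = j+j≤1+q+q⇒j≤q (≤-trans (≤-trans (m≤m+n (q + q) r) (≤-reflexive (sym (halving h))))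
                                (≤-trans h≤2n (≤-trans (≤-reflexive (cong (n +_) (+-identityʳ n))) (n≤1+n _))))
  n+r≡2⇒k≤2q : n + r ≡ 2 → k ≤ q + q
  n+r≡2⇒k≤2q n+r≡2 with r | r≤1 | k≤2q+r
  ... | 0 | _ | k≤2q+0 = subst (k ≤_) (+-identityʳ (q + q)) k≤2q+0
  ... | 1 | _ | _ = ⊥-elim (<-irrefl (sym n+r≡2) (+-monoˡ-≤ 1 2≤n))
  ... | suc (suc _) | s≤s () | _
  n+h≡N : n + h ≡ n + r + (q + q)
  n+h≡N = trans (cong (n +_) (halving h)) (trans (cong (n +_) (+-comm (q + q) r)) (sym (+-assoc n r (q + q))))
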